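{- Let $\mathcal B$ be a building set on a finite set $V$, and let $\mathcal N,\mathcal N'$ be inclusion-maximal $\mathcal B$-nested sets with $\mathcal N\setminus\{B\}=\mathcal N'\setminus\{B'\}$, $B\neq B'$, and parent $P$. Then the unique (up to rescaling) linear dependence between the $\mathbf g$-vectors of $\mathcal N\cup\mathcal N'$ is $$\mathbf g_B+\mathbf g_{B'}+\sum_{K\in\kappa(P\setminus(B\cup B'))}\mathbf g_K=\mathbf g_P+\sum_{K\in\kappa(B\cap B')}\mathbf g_K.$$ In particular, this dependence only depends on the exchange frame $(B,B',P)$.
   Context: A building set on $V$ is a set $\mathcal B$ of non-empty subsets of $V$ containing all singletons such that $B\cap B'\ne\varnothing$ implies $B\cup B'\in\mathcal B$; $\kappa(\mathcal B)$ is its set of inclusion-maximal blocks, and for $U\subseteq V$, $\kappa(U)$ is the set of inclusion-maximal blocks contained in $U$. A $\mathcal B$-nested set is $\mathcal N\subseteq\mathcal B$ whose members are pairwise nested or disjoint, with no union of $k\ge2$ pairwise disjoint members in $\mathcal B$, and $\kappa(\mathcal B)\subseteq\mathcal N$. The parent of the exchange is the unique inclusion-minimal element of $\{C\in\mathcal N:B\subsetneq C\}=\{C\in\mathcal N':B'\subsetneq C\}$, and $(B,B',P)$ is the exchange frame. Let $\mathbb H=\{x\in\mathbb R^V:\sum_{v\in K}x_v=0\ \forall K\in\kappa(\mathcal B)\}$ and $\mathbf g_C$ the orthogonal projection onto $\mathbb H$ of $\sum_{v\in C}e_v$ (so $\mathbf g_K=0$ for $K\in\kappa(\mathcal B)$;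 such zero vectors are disregarded when speaking of linear dependences among the $\mathbf g$-vectors). -}

module Defs where

open import Data.Nat using (ℕ; zero; suc; _≥_)
open import Data.Bool using (Bool; true; false; _∧_; _∨_; not; if_then_else_)
import Data.Bool as Bool
open import Data.Fin using (Fin)
open import Data.Fin.Subset hiding (_-_)
open import Data.Fin.Subset.Properties using (_⊆?_; _∈?_)
open import Data.Vec using ([]; _∷_)
open import Data.Vec.Properties using (≡-dec)
open import Data.List using (List; length)
open import Data.List.Relation.Unary.All using (All)
open import Data.List.Relation.Unary.AllPairs using (AllPairs)
open import Data.Product using (_×_)
open import Data.Sum using (_⊎_)
open import Data.Rational using (ℚ; 0ℚ; 1ℚ; _+_; _-_; _*_)
open import Relation.Nullary using (¬_; Dec; yes; no; does)
open import Relation.Binary.PropositionalEquality using (_≡_; _≢_)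

Family : ℕ → Set
Family n = Subset n → Bool

module _ {n : ℕ} where

  _==_ : Subset n → Subset n → Bool
  C == D = does (≡-dec Bool._≟_ C D)

  _⊆ᵇ_ : Subset n → Subset n → Bool
  C ⊆ᵇ D = does (C ⊆? D)

allSub : ∀ {n} → (Subset n → Bool) → Bool
allSub {zero}  f = f []
allSub {suc n} f = allSub (λ p → f (outside ∷ p)) ∧ allSub (λ p → f (inside ∷ p))

sumSub : ∀ {n} → (Subset n → ℚ) → ℚ
sumSub {zero}  f = f []
sumSub {suc n} f = sumSub (λ p → f (outside ∷ p)) + sumSub (λ p → f (inside ∷ p))

∑ : ∀ {n} → (Fin n → ℚ) → ℚ
∑ {zero}  f = 0ℚ
∑ {suc n} f = f Fin.zero + ∑ (λ i → f (Fin.suc i))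

[_]ℚ : Bool → ℚ
[ b ]ℚ = if b then 1ℚ else 0ℚ

module _ {n : ℕ} where

  sumOver : Subset n → (Fin n → ℚ) → ℚ
  sumOver U x = ∑ (λ v → if does (v ∈? U) then x v else 0ℚ)

  ind : Subset n → Fin n → ℚ
  ind C v = if does (v ∈? C) then 1ℚ else 0ℚ

  dot : (Fin n → ℚ) → (Fin n → ℚ) → ℚ
  dot x y = ∑ (λ v → x v * y v)

  ZeroVec : (Fin n → ℚ) → Set
  ZeroVec x = ∀ v → x v ≡ 0ℚ

  record IsBuildingSet (𝓑 : Family n) : Set where
    field
      nonempty   : ∀ B → 𝓑 B ≡ true → Nonempty B
      singletons : ∀ v → 𝓑 ⁅ v ⁆ ≡ true
      union      : ∀ B B' → 𝓑 B ≡ true → 𝓑 B' ≡ true →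
                   Nonempty (B ∩ B') → 𝓑 (B ∪ B') ≡ true

  -- κ(U): the inclusion-maximal blocks contained in U
  kappa : Family n → Subset n → Family n
  kappa 𝓑 U K = 𝓑 K ∧ (K ⊆ᵇ U) ∧
    allSub (λ K' → not (𝓑 K' ∧ (K ⊆ᵇ K') ∧ (K' ⊆ᵇ U)) ∨ (K' == K))

  kappaB : Family n → Family n
  kappaB 𝓑 = kappa 𝓑 ⊤

  record IsNested (𝓑 : Family n) (N : Family n) : Set where
    field
      blocks   : ∀ C → N C ≡ true → 𝓑 C ≡ true
      laminar  : ∀ C C' → N C ≡ true → N C' ≡ true →
                 C ⊆ C' ⊎ C' ⊆ C ⊎ Empty (C ∩ C')
      noUnion  : (L : List (Subset n)) → length L ≥ 2 →
                 All (λ C → N C ≡ true) L →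
                 AllPairs (λ C C' → Empty (C ∩ C')) L →
                 𝓑 (⋃ L) ≡ false
      maxBlocks : ∀ K → kappaB 𝓑 K ≡ true → N K ≡ true

  IsMaxNested : Family n → Family n → Set
  IsMaxNested 𝓑 N = IsNested 𝓑 N ×
    (∀ N' → IsNested 𝓑 N' → (∀ C → N C ≡ true → N' C ≡ true) →
       ∀ C → N' C ≡ true → N C ≡ true)

  IsParent : Family n → Subset n → Subset n → Set
  IsParent N B P = N P ≡ true × B ⊂ P ×
    (∀ C → N C ≡ true → B ⊂ C → ¬ (C ⊂ P))

  InH : Family n → (Fin n → ℚ) → Set
  InH 𝓑 x = ∀ K → kappaB 𝓑 K ≡ true → sumOver K x ≡ 0ℚ

  IsOrthProj : Family n → (Fin n → ℚ) → (Fin n → ℚ) → Set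
  IsOrthProj 𝓑 x y = InH 𝓑 y ×
    (∀ h → InH 𝓑 h → dot (λ v → x v - y v) h ≡ 0ℚ)

  -- coefficients of the claimed dependence (LHS minus RHS)
  exchangeCoeff : Family n → Subset n → Subset n → Subset n → Subset n → ℚ
  exchangeCoeff 𝓑 B B' P C =
    [ C == B ]ℚ + [ C == B' ]ℚ + [ kappa 𝓑 (P ─ (B ∪ B')) C ]ℚ
      - [ C == P ]ℚ - [ kappa 𝓑 (B ∩ B') C ]ℚ

{-# OPTIONS --safe #-}
module Submission where

open import Defs
open import Data.Nat as ℕ using (ℕ; zero; suc; _≥_; s≤s; z≤n)
import Data.Nat.Properties as ℕ
open import Data.Bool using (Bool; true; false; _∧_; _∨_; not; if_then_else_)
import Data.Bool as Bool
open import Data.Bool.Properties using (¬-not)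
open import Data.Fin using (Fin)
import Data.Fin as Fin
import Data.Fin.Properties as Fin
open import Data.Fin.Subset hiding (_-_)
open import Data.Fin.Subset.Properties
open import Data.Vec using ([]; _∷_; here; there)
import Data.Vec as Vec
open import Data.Vec.Properties using (≡-dec)
open import Data.List using (List; []; _∷_; length; map; _++_; filter)
open import Data.List.Membership.Propositional using () renaming (_∈_ to _∈ₗ_)
open import Data.List.Membership.Propositional.Properties
  using (∈-++⁺ˡ; ∈-++⁺ʳ; ∈-map⁺; ∈-map⁻; ∈-filter⁺; ∈-filter⁻)
open import Data.List.Relation.Unary.All as All using (All; []; _∷_)
open import Data.List.Relation.Unary.Any as Any using (any?)
open import Data.List.Relation.Unary.AllPairs using (AllPairs; []; _∷_)
import Data.List.Relation.Unary.AllPairs.Properties as AllPairs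
open import Data.List.Relation.Unary.Unique.Propositional using (Unique)
import Data.List.Relation.Unary.Unique.Propositional.Properties as Unique
open import Data.Product using (_×_; _,_; proj₁; proj₂; ∃; Σ; swap; uncurry)
open import Data.Sum using (_⊎_; inj₁; inj₂; [_,_]′)
open import Data.Empty using (⊥-elim) renaming (⊥ to Void)
open import Data.Rational using (ℚ; 0ℚ; 1ℚ; _+_; _-_; _*_; -_; _≤_; positive; negative)
import Data.Rational.Properties as ℚ
open import Algebra.Bundles using (CommutativeMonoid)
open import Algebra.Properties.CommutativeSemigroup (CommutativeMonoid.commutativeSemigroup ℚ.+-0-commutativeMonoid)
  using () renaming (interchange to +-interchange)
open import Algebra.Properties.Group ℚ.+-0-group using () renaming (x∙y⁻¹≈ε⇒x≈y to p-q≡0⇒p≡q)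
open import Data.Rational.Solver using (module +-*-Solver)
open +-*-Solver using (solve; _:+_; _:*_; _:-_; _:=_; con)
open import Function using (_∘_; _∋_)
open import Relation.Binary using (tri<; tri≈; tri>)
open import Relation.Nullary using (¬_; Dec; yes; no; does)
open import Relation.Nullary.Decidable using (_×-dec_; ¬?; dec-true; dec-false; decidable-stable; toSum)
open import Relation.Binary.PropositionalEquality
  using (_≡_; _≢_; refl; sym; trans; cong; cong₂; subst; subst₂; module ≡-Reasoning)

-- Before projecting, the identity already holds for the indicator vectors 1_C: the blocks of
-- κ(P ─ (B ∪ B′)) and of κ(B ∩ B′) partition these two sets, and B, B′ ⊆ P, so it is
-- inclusion-exclusion; orthogonal projection onto ℍ is linear. For the coefficients to be supported
-- on N ∪ N′ one needs that B′ ⊆ P and that all these blocks lie in N, which holds because N is a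
-- maximal nested set: otherwise the offending block could be added to N (or B′ to N).
-- For uniqueness, subtract the multiple of the exchange dependence that agrees at B′. What remains
-- is a dependence among the g-vectors of N alone, and these are independent: every non-maximal
-- C ∈ N has a private element v (in C but in no smaller member of N), its parent Q has one, w, and
-- pairing the dependence with e_v - e_w ∈ ℍ isolates the coefficient of C.

private variable
  n : ℕ
  a b : Bool
  C D : Subset n

∧⁻ˡ : a ∧ b ≡ true → a ≡ true
∧⁻ˡ {true} _ = refl

∧⁻ʳ : a ∧ b ≡ true → b ≡ true
∧⁻ʳ {true} h = h

∧⁺ : a ≡ true → b ≡ true → a ∧ b ≡ true
∧⁺ refl refl = refl

∨⁻ : a ∨ b ≡ true → a ≡ true ⊎ b ≡ true
∨⁻ {true} _ = inj₁ refl
∨⁻ {false} h = inj₂ h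

∨⁺ˡ : a ≡ true → a ∨ b ≡ true
∨⁺ˡ refl = refl

∨⁺ʳ : b ≡ true → a ∨ b ≡ true
∨⁺ʳ {a = true} _ = refl
∨⁺ʳ {a = false} h = h

∨-false⁻ˡ : a ∨ b ≡ false → a ≡ false
∨-false⁻ˡ {false} _ = refl

∨-false⁻ʳ : a ∨ b ≡ false → b ≡ false
∨-false⁻ʳ {false} h = h

∨-false : a ≡ false → b ≡ false → a ∨ b ≡ false
∨-false refl refl = refl

true≢false : a ≡ true → a ≢ false
true≢false refl ()

false-true⇒≢ : ∀ {A : Set} {f : A → Bool} {x y} → f x ≡ false → f y ≡ true → x ≢ y
false-true⇒≢ fx fy refl = true≢false fy fx

∧-not⁺ : a ≡ true → b ≡ false → a ∧ not b ≡ true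
∧-not⁺ refl refl = refl

∧-not-true : b ≡ true → a ∧ not b ≡ false
∧-not-true {a = false} _ = refl
∧-not-true {a = true} refl = refl

implies⇒not∧∨ : ∀ c d → (a ≡ true → c ≡ true → d ≡ true) → not (a ∧ c) ∨ d ≡ true
implies⇒not∧∨ {true} true d h = h refl refl
implies⇒not∧∨ {true} false d h = refl
implies⇒not∧∨ {false} c d h = refl

not∧∨⇒implies : ∀ {c d} → not (a ∧ c) ∨ d ≡ true → a ≡ true → c ≡ true → d ≡ true
not∧∨⇒implies h refl refl = h

does≡true⇒ : ∀ {A : Set} (a? : Dec A) → does a? ≡ true → A
does≡true⇒ (yes a) _ = a

allSub⁻ : (f : Subset n → Bool) → allSub f ≡ true → ∀ p → f p ≡ true
allSub⁻ {zero} f h [] = h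
allSub⁻ {suc n} f h (false ∷ p) = allSub⁻ (λ p → f (outside ∷ p)) (∧⁻ˡ h) p
allSub⁻ {suc n} f h (true ∷ p) =
  allSub⁻ (λ p → f (inside ∷ p)) (∧⁻ʳ {allSub (λ p → f (outside ∷ p))} h) p

allSub⁺ : (f : Subset n → Bool) → (∀ p → f p ≡ true) → allSub f ≡ true
allSub⁺ {zero} f h = h []
allSub⁺ {suc n} f h = ∧⁺ (allSub⁺ _ (λ p → h (outside ∷ p))) (allSub⁺ _ (λ p → h (inside ∷ p)))

module _ {C D : Subset n} where

  ==⇒≡ : (C == D) ≡ true → C ≡ D
  ==⇒≡ = does≡true⇒ (≡-dec Bool._≟_ C D)

  ≡⇒== : C ≡ D → (C == D) ≡ true
  ≡⇒== = dec-true (≡-dec Bool._≟_ C D)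

  ≢⇒== : C ≢ D → (C == D) ≡ false
  ≢⇒== = dec-false (≡-dec Bool._≟_ C D)

  ⊆ᵇ⇒⊆ : (C ⊆ᵇ D) ≡ true → C ⊆ D
  ⊆ᵇ⇒⊆ = does≡true⇒ (C ⊆? D)

  ⊆⇒⊆ᵇ : C ⊆ D → (C ⊆ᵇ D) ≡ true
  ⊆⇒⊆ᵇ = dec-true (C ⊆? D)

==-refl : {C : Subset n} → (C == C) ≡ true
==-refl {C = C} = ≡⇒== {C = C} {C} refl

∪-least : ∀ {A B C : Subset n} → A ⊆ C → B ⊆ C → A ∪ B ⊆ C
∪-least {A = A} {B} A⊆C B⊆C m = [ A⊆C , B⊆C ]′ (x∈p∪q⁻ A B m)

∈-∪ˡ : ∀ {A B : Subset n} {x} → x ∈ A → x ∈ A ∪ B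
∈-∪ˡ m = x∈p∪q⁺ (inj₁ m)

∈-∪ʳ : ∀ {A B : Subset n} {x} → x ∈ B → x ∈ A ∪ B
∈-∪ʳ m = x∈p∪q⁺ (inj₂ m)

x∈p─q⇒x∉q : ∀ (p q : Subset n) {x} → x ∈ p ─ q → x ∉ q
x∈p─q⇒x∉q (true ∷ p) (false ∷ q) here = λ ()
x∈p─q⇒x∉q (_ ∷ p) (_ ∷ q) (there m) (there m′) = x∈p─q⇒x∉q p q m m′

x∈q⇒x∉p─q : ∀ (p q : Subset n) {x} → x ∈ q → x ∉ p ─ q
x∈q⇒x∉p─q p q x∈q x∈p─q = x∈p─q⇒x∉q p q x∈p─q x∈q

Nonempty⇒⊈─ : ∀ {E} → Nonempty C → C ⊆ D → ¬ C ⊆ E ─ D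
Nonempty⇒⊈─ {D = D} {E = E} (x , x∈C) C⊆D C⊆E─D = x∈q⇒x∉p─q E D (C⊆D x∈C) (C⊆E─D x∈C)

Disjoint : Subset n → Subset n → Set
Disjoint C D = Empty (C ∩ D)

Laminar : Subset n → Subset n → Set
Laminar C D = C ⊆ D ⊎ D ⊆ C ⊎ Disjoint C D

Nonempty∩-sym : Nonempty (C ∩ D) → Nonempty (D ∩ C)
Nonempty∩-sym {C = C} {D = D} (x , m) = x , x∈p∩q⁺ (swap (x∈p∩q⁻ C D m))

Disjoint⇒∉ : Disjoint C D → ∀ {x} → x ∈ C → x ∉ D
Disjoint⇒∉ dj xC xD = dj (_ , x∈p∩q⁺ (xC , xD))

∉⇒Disjoint : (∀ {x} → x ∈ C → x ∉ D) → Disjoint C D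
∉⇒Disjoint {C = C} {D = D} h (x , m) = uncurry h (x∈p∩q⁻ C D m)

Disjoint-sym : Disjoint C D → Disjoint D C
Disjoint-sym dj = dj ∘ Nonempty∩-sym

Laminar-sym : Laminar C D → Laminar D C
Laminar-sym (inj₁ C⊆D) = inj₂ (inj₁ C⊆D)
Laminar-sym (inj₂ (inj₁ D⊆C)) = inj₁ D⊆C
Laminar-sym (inj₂ (inj₂ dj)) = inj₂ (inj₂ (Disjoint-sym dj))

Nonempty⇒¬Disjoint : Nonempty C → C ⊆ D → ¬ Disjoint C D
Nonempty⇒¬Disjoint (x , xC) C⊆D dj = Disjoint⇒∉ dj xC (C⊆D xC)

⊆∧≢⇒⊂ : C ⊆ D → C ≢ D → C ⊂ D
⊆∧≢⇒⊂ {C = C} {D = D} C⊆D C≢D with Fin.any? (λ x → (x ∈? D) ×-dec ¬? (x ∈? C))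
... | yes witness = C⊆D , witness
... | no none = ⊥-elim (C≢D (⊆-antisym C⊆D D⊆C))
  where
  D⊆C : D ⊆ C
  D⊆C {x} xD = decidable-stable (x ∈? C) λ x∉C → none (x , xD , x∉C)

_⊈?_ : ∀ (C D : Subset n) → Dec (¬ C ⊆ D)
C ⊈? D = ¬? (C ⊆? D)

⊂⇒≢ : C ⊂ D → C ≢ D
⊂⇒≢ (_ , x , xD , x∉C) refl = x∉C xD

⊆∧≢⇒⊃ : C ⊆ D → D ≢ C → C ⊂ D
⊆∧≢⇒⊃ C⊆D D≢C = ⊆∧≢⇒⊂ C⊆D (D≢C ∘ sym)

module _ (Q : Subset n → Bool) where

  Maximal : Subset n → Set
  Maximal Y = Q Y ≡ true × (∀ Z → Q Z ≡ true → Y ⊆ Z → Z ≡ Y)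

  Minimal : Subset n → Set
  Minimal Y = Q Y ≡ true × (∀ Z → Q Z ≡ true → Z ⊆ Y → Z ≡ Y)

  maximal? : Subset n → Bool
  maximal? Y = Q Y ∧ allSub (λ Z → not (Q Z ∧ (Y ⊆ᵇ Z)) ∨ (Z == Y))

  maximal?⁻ : ∀ {Y} → maximal? Y ≡ true → Maximal Y
  maximal?⁻ {Y} h = ∧⁻ˡ h , λ Z qZ Y⊆Z →
    ==⇒≡ (not∧∨⇒implies (allSub⁻ _ (∧⁻ʳ {Q Y} h) Z) qZ (⊆⇒⊆ᵇ Y⊆Z))

  maximal?⁺ : ∀ {Y} → Maximal Y → maximal? Y ≡ true
  maximal?⁺ (qY , max) = ∧⁺ qY (allSub⁺ _ λ Z →
    implies⇒not∧∨ _ _ λ qZ Y⊆Z → ≡⇒== (max Z qZ (⊆ᵇ⇒⊆ Y⊆Z)))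

  maximal-above : ∀ X → Q X ≡ true → ∃ λ Y → X ⊆ Y × Maximal Y
  maximal-above X qX = go (suc n) X (s≤s (ℕ.m≤m+n n ∣ X ∣)) qX
    where
    go : ∀ k X → n ℕ.< k ℕ.+ ∣ X ∣ → Q X ≡ true → ∃ λ Y → X ⊆ Y × Maximal Y
    go zero X lt qX = ⊥-elim (ℕ.<⇒≱ lt (∣p∣≤n X))
    go (suc k) X lt qX with anySubset? (λ Z → (Q Z Bool.≟ true) ×-dec (X ⊂? Z))
    ... | yes (Z , qZ , X⊂Z) =
      let Y , Z⊆Y , maxY = go k Z (ℕ.<-≤-trans lt (subst (ℕ._≤ k ℕ.+ ∣ Z ∣) (ℕ.+-suc k ∣ X ∣)
                                   (ℕ.+-monoʳ-≤ k (p⊂q⇒∣p∣<∣q∣ X⊂Z)))) qZ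
      in Y , ⊆-trans (proj₁ X⊂Z) Z⊆Y , maxY
    ... | no none = X , ⊆-refl , qX , λ Z qZ X⊆Z →
      decidable-stable (≡-dec Bool._≟_ Z X) λ Z≢X → none (Z , qZ , ⊆∧≢⇒⊃ X⊆Z Z≢X)

  minimal-below : ∀ X → Q X ≡ true → ∃ λ Y → Y ⊆ X × Minimal Y
  minimal-below X qX = go (suc n) X (s≤s (∣p∣≤n X)) qX
    where
    go : ∀ k X → ∣ X ∣ ℕ.< k → Q X ≡ true → ∃ λ Y → Y ⊆ X × Minimal Y
    go (suc k) X (s≤s lt) qX with anySubset? (λ Z → (Q Z Bool.≟ true) ×-dec (Z ⊂? X))
    ... | yes (Z , qZ , Z⊂X) =
      let Y , Y⊆Z , minY = go k Z (ℕ.<-≤-trans (p⊂q⇒∣p∣<∣q∣ Z⊂X) lt) qZ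
      in Y , ⊆-trans Y⊆Z (proj₁ Z⊂X) , minY
    ... | no none = X , ⊆-refl , qX , λ Z qZ Z⊆X →
      decidable-stable (≡-dec Bool._≟_ Z X) λ Z≢X → none (Z , qZ , ⊆∧≢⇒⊂ Z⊆X Z≢X)

allSubsets : ∀ n → List (Subset n)
allSubsets zero = [] ∷ []
allSubsets (suc n) = map (outside ∷_) (allSubsets n) ++ map (inside ∷_) (allSubsets n)

∈-allSubsets : (p : Subset n) → p ∈ₗ allSubsets n
∈-allSubsets [] = Any.here refl
∈-allSubsets (false ∷ p) = ∈-++⁺ˡ (∈-map⁺ (outside ∷_) (∈-allSubsets p))
∈-allSubsets {suc n} (true ∷ p) =
  ∈-++⁺ʳ (map (outside ∷_) (allSubsets n)) (∈-map⁺ (inside ∷_) (∈-allSubsets p))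

allSubsets-unique : ∀ n → Unique (allSubsets n)
allSubsets-unique zero = [] ∷ []
allSubsets-unique (suc n) =
  Unique.++⁺ (Unique.map⁺ ∷-injectiveʳ (allSubsets-unique n))
             (Unique.map⁺ ∷-injectiveʳ (allSubsets-unique n)) outside≢inside
  where
  ∷-injectiveʳ : ∀ {s : Bool} {p q : Subset n} → (Subset (suc n) ∋ s ∷ p) ≡ s ∷ q → p ≡ q
  ∷-injectiveʳ refl = refl
  outside≢inside : ∀ {r} → ¬ (r ∈ₗ map (outside ∷_) (allSubsets n) × r ∈ₗ map (inside ∷_) (allSubsets n))
  outside≢inside (r∈o , r∈i) with ∈-map⁻ (outside ∷_) r∈o | ∈-map⁻ (inside ∷_) r∈i
  ... | _ , _ , refl | _ , _ , ()

⋃⁺ : ∀ (L : List (Subset n)) {C x} → C ∈ₗ L → x ∈ C → x ∈ ⋃ L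
⋃⁺ (C ∷ L) (Any.here refl) x∈C = ∈-∪ˡ {B = ⋃ L} x∈C
⋃⁺ (C ∷ L) (Any.there C∈L) x∈C = ∈-∪ʳ {A = C} {B = ⋃ L} (⋃⁺ L C∈L x∈C)

⋃⁻ : ∀ (L : List (Subset n)) {x} → x ∈ ⋃ L → ∃ λ C → C ∈ₗ L × x ∈ C
⋃⁻ [] x∈⊥ = ⊥-elim (∉⊥ x∈⊥)
⋃⁻ (C ∷ L) x∈⋃ with x∈p∪q⁻ C (⋃ L) x∈⋃
... | inj₁ x∈C = C , Any.here refl , x∈C
... | inj₂ x∈⋃L = let D , D∈L , x∈D = ⋃⁻ L x∈⋃L in D , Any.there D∈L , x∈D

⋃⊆ : ∀ (L : List (Subset n)) {X} → All (_⊆ X) L → ⋃ L ⊆ X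
⋃⊆ L all m = let C , C∈L , x∈C = ⋃⁻ L m in All.lookup all C∈L x∈C

module _ {A : Set} {R : A → A → Set} where

  Unique⇒AllPairs : ∀ {L} → Unique L →
    (∀ {x y} → x ∈ₗ L → y ∈ₗ L → x ≢ y → R x y) → AllPairs R L
  Unique⇒AllPairs [] _ = []
  Unique⇒AllPairs (x∉L ∷ uL) r =
    All.tabulate (λ y∈L → r (Any.here refl) (Any.there y∈L) (All.lookup x∉L y∈L))
    ∷ Unique⇒AllPairs uL (λ x∈ y∈ → r (Any.there x∈) (Any.there y∈))

  AllPairs⇒⊎ : ∀ {L x y} → AllPairs R L → x ∈ₗ L → y ∈ₗ L → x ≢ y → R x y ⊎ R y x
  AllPairs⇒⊎ (r ∷ rs) (Any.here refl) (Any.here refl) x≢y = ⊥-elim (x≢y refl)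
  AllPairs⇒⊎ (r ∷ rs) (Any.here refl) (Any.there y∈) _ = inj₁ (All.lookup r y∈)
  AllPairs⇒⊎ (r ∷ rs) (Any.there x∈) (Any.here refl) _ = inj₂ (All.lookup r x∈)
  AllPairs⇒⊎ (r ∷ rs) (Any.there x∈) (Any.there y∈) x≢y = AllPairs⇒⊎ rs x∈ y∈ x≢y

  AllPairs-partner : ∀ {L x} → AllPairs R L → 2 ℕ.≤ length L → x ∈ₗ L →
    ∃ λ y → y ∈ₗ L × (R x y ⊎ R y x)
  AllPairs-partner {_ ∷ []} _ (s≤s ()) _
  AllPairs-partner {_ ∷ y ∷ _} ((r ∷ _) ∷ _) _ (Any.here refl) = y , Any.there (Any.here refl) , inj₁ r
  AllPairs-partner {y ∷ _ ∷ _} (r ∷ _) _ (Any.there x∈) = y , Any.here refl , inj₂ (All.lookup r x∈)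

module _ {L : List (Subset n)} (pairwise : AllPairs Disjoint L) where

  distinct⇒Disjoint : ∀ {C D} → C ∈ₗ L → D ∈ₗ L → C ≢ D → Disjoint C D
  distinct⇒Disjoint C∈ D∈ C≢D = [ (λ dj → dj) , Disjoint-sym ]′ (AllPairs⇒⊎ pairwise C∈ D∈ C≢D)

  disjoint-partner : 2 ℕ.≤ length L → ∀ {C} → C ∈ₗ L → ∃ λ D → D ∈ₗ L × Disjoint D C
  disjoint-partner two C∈ =
    let D , D∈ , dj = AllPairs-partner pairwise two C∈ in D , D∈ , [ Disjoint-sym , (λ dj → dj) ]′ dj

⋃-filter-split : ∀ {P : Subset n → Set} (P? : ∀ C → Dec (P C)) (L : List (Subset n)) {x} →
  x ∈ ⋃ L → x ∈ ⋃ (filter P? L) ⊎ ∃ λ C → C ∈ₗ L × ¬ P C × x ∈ C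
⋃-filter-split P? L x∈⋃ with ⋃⁻ L x∈⋃
... | C , C∈L , x∈C with P? C
...   | yes pC = inj₁ (⋃⁺ (filter P? L) (∈-filter⁺ P? C∈L pC) x∈C)
...   | no ¬pC = inj₂ (C , C∈L , ¬pC , x∈C)

module _ (𝓑 : Family n) where

  InKappa : Subset n → Subset n → Set
  InKappa U K = 𝓑 K ≡ true × K ⊆ U × (∀ K′ → 𝓑 K′ ≡ true → K ⊆ K′ → K′ ⊆ U → K′ ≡ K)

  kappa⁻ : ∀ {U K} → kappa 𝓑 U K ≡ true → InKappa U K
  kappa⁻ {U} {K} h = ∧⁻ˡ h , ⊆ᵇ⇒⊆ (∧⁻ˡ (∧⁻ʳ {𝓑 K} h)) , λ K′ bK′ K⊆K′ K′⊆U →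
    ==⇒≡ (not∧∨⇒implies (allSub⁻ _ (∧⁻ʳ {K ⊆ᵇ U} (∧⁻ʳ {𝓑 K} h)) K′) bK′ (∧⁺ (⊆⇒⊆ᵇ K⊆K′) (⊆⇒⊆ᵇ K′⊆U)))

  kappa⁺ : ∀ {U K} → InKappa U K → kappa 𝓑 U K ≡ true
  kappa⁺ {U} {K} (bK , K⊆U , max) = ∧⁺ bK (∧⁺ (⊆⇒⊆ᵇ K⊆U) (allSub⁺ _ λ K′ →
    implies⇒not∧∨ _ _ λ bK′ s → ≡⇒== (max K′ bK′ (⊆ᵇ⇒⊆ (∧⁻ˡ s)) (⊆ᵇ⇒⊆ (∧⁻ʳ {K ⊆ᵇ K′} s)))))

  kappa-false : ∀ {U X} → ¬ X ⊆ U → kappa 𝓑 U X ≡ false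
  kappa-false X⊈U = ¬-not λ κX → X⊈U (proj₁ (proj₂ (kappa⁻ κX)))

module BuildingSet (𝓑 : Family n) (bs : IsBuildingSet 𝓑) where
  open IsBuildingSet bs public

  InKappa-absorbs : ∀ {U K D} → InKappa 𝓑 U K → 𝓑 D ≡ true → D ⊆ U → Nonempty (D ∩ K) → D ⊆ K
  InKappa-absorbs {U} {K} {D} (bK , K⊆U , max) bD D⊆U D∩K x∈D =
    subst (_ ∈_) (max (D ∪ K) (union D K bD bK D∩K) (∈-∪ʳ {A = D}) (∪-least D⊆U K⊆U)) (∈-∪ˡ x∈D)

  InKappa-meet⇒≡ : ∀ {U K K′} → InKappa 𝓑 U K → InKappa 𝓑 U K′ → Nonempty (K ∩ K′) → K ≡ K′
  InKappa-meet⇒≡ κK κK′ K∩K′ =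
    ⊆-antisym (InKappa-absorbs κK′ (proj₁ κK) (proj₁ (proj₂ κK)) K∩K′)
              (InKappa-absorbs κK (proj₁ κK′) (proj₁ (proj₂ κK′)) (Nonempty∩-sym K∩K′))

  InKappa-covers : ∀ {U x} → x ∈ U → ∃ λ K → InKappa 𝓑 U K × x ∈ K
  InKappa-covers {U} {x} x∈U =
    let K , x⊆K , (bK∧K⊆U , max) = maximal-above (λ Y → 𝓑 Y ∧ (Y ⊆ᵇ U)) ⁅ x ⁆
                                      (∧⁺ (singletons x) (⊆⇒⊆ᵇ (⁅x⁆⊆ x∈U)))
    in K , (∧⁻ˡ bK∧K⊆U , ⊆ᵇ⇒⊆ (∧⁻ʳ {𝓑 K} bK∧K⊆U) , λ K′ bK′ K⊆K′ K′⊆U → max K′ (∧⁺ bK′ (⊆⇒⊆ᵇ K′⊆U)) K⊆K′)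
       , x⊆K (x∈⁅x⁆ x)
    where
    ⁅x⁆⊆ : ∀ {x : Fin n} {U} → x ∈ U → ⁅ x ⁆ ⊆ U
    ⁅x⁆⊆ x∈U y∈⁅x⁆ = subst (_∈ _) (sym (x∈⁅y⁆⇒x≡y _ y∈⁅x⁆)) x∈U

  maxBlock-above : ∀ {X} → 𝓑 X ≡ true → ∃ λ K → X ⊆ K × InKappa 𝓑 ⊤ K
  maxBlock-above bX =
    let K , X⊆K , bK , max = maximal-above 𝓑 _ bX in K , X⊆K , bK , ⊆⊤ , λ K′ bK′ K⊆K′ _ → max K′ bK′ K⊆K′

  ∪⋃-block : ∀ {X} → 𝓑 X ≡ true → (F : List (Subset n)) →
    All (λ C → 𝓑 C ≡ true × Nonempty (X ∩ C)) F → 𝓑 (X ∪ ⋃ F) ≡ true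
  ∪⋃-block {X} bX [] _ = subst (λ Z → 𝓑 Z ≡ true) (sym (∪-identityʳ X)) bX
  ∪⋃-block {X} bX (C ∷ F) ((bC , X∩C) ∷ rest) =
    subst (λ Z → 𝓑 Z ≡ true) regroup (union C (X ∪ ⋃ F) bC (∪⋃-block bX F rest) C∩X∪⋃F)
    where
    C∩X∪⋃F : Nonempty (C ∩ (X ∪ ⋃ F))
    C∩X∪⋃F = let x , m = Nonempty∩-sym X∩C ; x∈C , x∈X = x∈p∩q⁻ C X m in x , x∈p∩q⁺ (x∈C , ∈-∪ˡ x∈X)
    regroup : C ∪ (X ∪ ⋃ F) ≡ X ∪ (C ∪ ⋃ F)
    regroup = begin
      C ∪ (X ∪ ⋃ F)  ≡⟨ sym (∪-assoc C X (⋃ F)) ⟩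
      (C ∪ X) ∪ ⋃ F  ≡⟨ cong (_∪ ⋃ F) (∪-comm C X) ⟩
      (X ∪ C) ∪ ⋃ F  ≡⟨ ∪-assoc X C (⋃ F) ⟩
      X ∪ (C ∪ ⋃ F)  ∎
      where open ≡-Reasoning

  InKappa-unsplittable : ∀ {U X} {L : List (Subset n)} → InKappa 𝓑 U X →
    AllPairs Disjoint L → 2 ℕ.≤ length L → X ∈ₗ L → All (λ C → 𝓑 C ≡ true) L →
    𝓑 (⋃ L) ≡ true → ⋃ L ⊆ U → Void
  InKappa-unsplittable {L = L} (_ , _ , max) pairwise two X∈L blocks b⋃L ⋃L⊆U =
    let D , D∈L , D∩X = disjoint-partner pairwise two X∈L
        x , x∈D = nonempty _ (All.lookup blocks D∈L)
        ⋃L≡X = max (⋃ L) b⋃L (⋃⁺ L X∈L) ⋃L⊆U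
    in Disjoint⇒∉ D∩X x∈D (subst (x ∈_) ⋃L≡X (⋃⁺ L D∈L x∈D))

-- Nested sets

module Nested {𝓑 : Family n} (bs : IsBuildingSet 𝓑) {S : Family n} (ns : IsNested 𝓑 S) where
  open BuildingSet 𝓑 bs
  open IsNested ns

  ⋃⊆member : ∀ {A} {L : List (Subset n)} → S A ≡ true → AllPairs Disjoint L → 𝓑 (⋃ L) ≡ true →
    Nonempty (⋃ L ∩ A) → All (λ C → C ⊆ A ⊎ (S C ≡ true × Disjoint C A)) L → ⋃ L ⊆ A
  -- Otherwise the members of L outside A, together with A, are disjoint members of S whose union
  -- ⋃ L ∪ A is a block.
  ⋃⊆member {A} {L} sA pairwise b⋃L ⋃L∩A cases with filter (_⊈? A) L in eq
  ... | [] = λ x∈⋃L → [ (λ x∈⋃F → ⊥-elim (∉⊥ (subst (λ F → _ ∈ ⋃ F) eq x∈⋃F))) , lies-in-A ]′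
                        (⋃-filter-split (_⊈? A) L x∈⋃L)
    where
    lies-in-A : ∀ {x} → (∃ λ C → C ∈ₗ L × ¬ ¬ C ⊆ A × x ∈ C) → x ∈ A
    lies-in-A (C , _ , ¬¬C⊆A , x∈C) = decidable-stable (C ⊆? A) ¬¬C⊆A x∈C
  ... | F@(_ ∷ _) = ⊥-elim (true≢false b⋃A∷F
                      (noUnion (A ∷ F) (s≤s (s≤s z≤n)) (sA ∷ All.map proj₁ outsiders)
                               (All.map (Disjoint-sym ∘ proj₂) outsiders ∷ F-pairwise)))
    where
    outsiders : All (λ C → S C ≡ true × Disjoint C A) F
    outsiders = All.tabulate λ C∈F →
      let C∈L , C⊈A = ∈-filter⁻ (_⊈? A) (subst (_ ∈ₗ_) (sym eq) C∈F)
      in [ ⊥-elim ∘ C⊈A , (λ out → out) ]′ (All.lookup cases C∈L)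
    F-pairwise : AllPairs Disjoint F
    F-pairwise = subst (AllPairs Disjoint) eq (AllPairs.filter⁺ (_⊈? A) pairwise)
    ⋃L∪A≡A∪⋃F : ⋃ L ∪ A ≡ A ∪ ⋃ F
    ⋃L∪A≡A∪⋃F = ⊆-antisym
      (∪-least (λ x∈⋃L → [ ∈-∪ʳ {A = A} ∘ subst (λ F → _ ∈ ⋃ F) eq
                         , (λ (C , _ , ¬¬C⊆A , x∈C) → ∈-∪ˡ (decidable-stable (C ⊆? A) ¬¬C⊆A x∈C)) ]′
                         (⋃-filter-split (_⊈? A) L x∈⋃L))
               (∈-∪ˡ {B = ⋃ F}))
      (∪-least (∈-∪ʳ {A = ⋃ L})
               (λ x∈⋃F → let C , C∈F , x∈C = ⋃⁻ F x∈⋃F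
                             C∈L , _ = ∈-filter⁻ (_⊈? A) (subst (_ ∈ₗ_) (sym eq) C∈F)
                         in ∈-∪ˡ (⋃⁺ L C∈L x∈C)))
    b⋃A∷F : 𝓑 (A ∪ ⋃ F) ≡ true
    b⋃A∷F = subst (λ Z → 𝓑 Z ≡ true) ⋃L∪A≡A∪⋃F (union (⋃ L) A b⋃L (blocks A sA) ⋃L∩A)

  ⋃⊆member-around : ∀ {A X} {L : List (Subset n)} → S A ≡ true → X ⊆ A → Nonempty X →
    AllPairs Disjoint L → 𝓑 (⋃ L) ≡ true → X ∈ₗ L →
    All (λ C → C ≡ X ⊎ (S C ≡ true × Disjoint C X)) L → ⋃ L ⊆ A
  ⋃⊆member-around {A} {X} {L} sA X⊆A (x , x∈X) pairwise b⋃L X∈L around =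
    ⋃⊆member sA pairwise b⋃L (x , x∈p∩q⁺ (⋃⁺ L X∈L x∈X , X⊆A x∈X)) (All.map classify around)
    where
    classify : ∀ {C} → C ≡ X ⊎ (S C ≡ true × Disjoint C X) → C ⊆ A ⊎ (S C ≡ true × Disjoint C A)
    classify (inj₁ refl) = inj₁ X⊆A
    classify {C} (inj₂ (sC , C∩X)) with laminar C A sC sA
    ... | inj₁ C⊆A = inj₁ C⊆A
    ... | inj₂ (inj₁ A⊆C) = ⊥-elim (Disjoint⇒∉ C∩X (A⊆C (X⊆A x∈X)) x∈X)
    ... | inj₂ (inj₂ C∩A) = inj₂ (sC , C∩A)

  block-inside-member : ∀ {X} (L : List (Subset n)) → All (λ C → S C ≡ true) L →
    AllPairs Disjoint L → 𝓑 X ≡ true → X ⊆ ⋃ L → ∃ λ C → C ∈ₗ L × X ⊆ C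
  block-inside-member {X} L members pairwise bX X⊆⋃L = go (filter meets? L) refl
    where
    meets? : ∀ C → Dec (Nonempty (X ∩ C))
    meets? C = nonempty? (X ∩ C)
    hit : ∀ {F x} → filter meets? L ≡ F → x ∈ X → ∃ λ C → C ∈ₗ F × x ∈ C
    hit eq x∈X =
      let C , C∈L , x∈C = ⋃⁻ L (X⊆⋃L x∈X)
      in C , subst (_ ∈ₗ_) eq (∈-filter⁺ meets? C∈L (_ , x∈p∩q⁺ (x∈X , x∈C))) , x∈C
    go : ∀ F → filter meets? L ≡ F → ∃ λ C → C ∈ₗ L × X ⊆ C
    go [] eq with hit eq (proj₂ (nonempty X bX))
    ... | _ , () , _
    go (C ∷ []) eq = C , proj₁ (∈-filter⁻ meets? (subst (C ∈ₗ_) (sym eq) (Any.here refl))) , only ∘ hit eq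
      where
      only : ∀ {x} → (∃ λ D → D ∈ₗ C ∷ [] × x ∈ D) → x ∈ C
      only (_ , Any.here refl , x∈C) = x∈C
    go F@(_ ∷ _ ∷ _) eq = ⊥-elim (true≢false b⋃F (noUnion F (s≤s (s≤s z≤n)) (All.map proj₁ F-meets) F-pairwise))
      where
      F-meets : All (λ C → S C ≡ true × Nonempty (X ∩ C)) F
      F-meets = All.tabulate λ C∈F →
        let C∈L , X∩C = ∈-filter⁻ meets? (subst (_ ∈ₗ_) (sym eq) C∈F) in All.lookup members C∈L , X∩C
      F-pairwise : AllPairs Disjoint F
      F-pairwise = subst (AllPairs Disjoint) eq (AllPairs.filter⁺ meets? pairwise)
      X∪⋃F≡⋃F : X ∪ ⋃ F ≡ ⋃ F
      X∪⋃F≡⋃F = ⊆-antisym (∪-least (λ x∈X → let C , C∈F , x∈C = hit eq x∈X in ⋃⁺ F C∈F x∈C) ⊆-refl)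
                          (∈-∪ʳ {A = X})
      b⋃F : 𝓑 (⋃ F) ≡ true
      b⋃F = subst (λ Z → 𝓑 Z ≡ true) X∪⋃F≡⋃F
              (∪⋃-block bX F (All.map (λ (sC , X∩C) → blocks _ sC , X∩C) F-meets))

  strictlyBelow : Subset n → Subset n → Bool
  strictlyBelow C Z = S Z ∧ does (Z ⊂? C)

  strictlyBelow⁻ : ∀ {C Z} → strictlyBelow C Z ≡ true → S Z ≡ true × Z ⊂ C
  strictlyBelow⁻ {C} {Z} h = ∧⁻ˡ h , does≡true⇒ (Z ⊂? C) (∧⁻ʳ {S Z} h)

  strictlyBelow⁺ : ∀ {C Z} → S Z ≡ true → Z ⊂ C → strictlyBelow C Z ≡ true
  strictlyBelow⁺ {C} {Z} sZ Z⊂C = ∧⁺ sZ (dec-true (Z ⊂? C) Z⊂C)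

  strictlyAbove : Subset n → Subset n → Bool
  strictlyAbove C Z = S Z ∧ does (C ⊂? Z)

  strictlyAbove⁻ : ∀ {C Z} → strictlyAbove C Z ≡ true → S Z ≡ true × C ⊂ Z
  strictlyAbove⁻ {C} {Z} h = ∧⁻ˡ h , does≡true⇒ (C ⊂? Z) (∧⁻ʳ {S Z} h)

  strictlyAbove⁺ : ∀ {C Z} → S Z ≡ true → C ⊂ Z → strictlyAbove C Z ≡ true
  strictlyAbove⁺ {C} {Z} sZ C⊂Z = ∧⁺ sZ (dec-true (C ⊂? Z) C⊂Z)

  children : Subset n → List (Subset n)
  children C = filter (λ Z → maximal? (strictlyBelow C) Z Bool.≟ true) (allSubsets n)

  module _ {C : Subset n} where

    child⁻ : ∀ {D} → D ∈ₗ children C → Maximal (strictlyBelow C) D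
    child⁻ D∈ = maximal?⁻ (strictlyBelow C)
      (proj₂ (∈-filter⁻ (λ Z → maximal? (strictlyBelow C) Z Bool.≟ true) {xs = allSubsets n} D∈))

    children-members : All (λ D → S D ≡ true) (children C)
    children-members = All.tabulate (proj₁ ∘ strictlyBelow⁻ ∘ proj₁ ∘ child⁻)

    children-⊂ : ∀ {D} → D ∈ₗ children C → D ⊂ C
    children-⊂ = proj₂ ∘ strictlyBelow⁻ ∘ proj₁ ∘ child⁻

    children-pairwise : AllPairs Disjoint (children C)
    children-pairwise = Unique⇒AllPairs (Unique.filter⁺ _ (allSubsets-unique n)) distinct
      where
      distinct : ∀ {D E} → D ∈ₗ children C → E ∈ₗ children C → D ≢ E → Disjoint D E
      distinct {D} {E} D∈ E∈ D≢E
        with laminar D E (All.lookup children-members D∈) (All.lookup children-members E∈)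
      ... | inj₁ D⊆E = ⊥-elim (D≢E (sym (proj₂ (child⁻ D∈) E (proj₁ (child⁻ E∈)) D⊆E)))
      ... | inj₂ (inj₁ E⊆D) = ⊥-elim (D≢E (proj₂ (child⁻ E∈) D (proj₁ (child⁻ D∈)) E⊆D))
      ... | inj₂ (inj₂ D∩E) = D∩E

    ∈⋃children : ∀ {D x} → S D ≡ true → D ⊂ C → x ∈ D → x ∈ ⋃ (children C)
    ∈⋃children sD D⊂C x∈D =
      let E , D⊆E , maxE = maximal-above (strictlyBelow C) _ (strictlyBelow⁺ sD D⊂C)
      in ⋃⁺ (children C) (∈-filter⁺ (λ Z → maximal? (strictlyBelow C) Z Bool.≟ true) (∈-allSubsets E)
                                     (maximal?⁺ (strictlyBelow C) maxE)) (D⊆E x∈D)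

  Private : Subset n → Fin n → Set
  Private C v = v ∈ C × (∀ D → S D ≡ true → D ⊂ C → v ∉ D)

  ¬Private⇒∈⋃children : ∀ {C v} → v ∈ C → ¬ Private C v → v ∈ ⋃ (children C)
  ¬Private⇒∈⋃children {C} {v} v∈C ¬private
    with anySubset? (λ D → (S D Bool.≟ true) ×-dec ((D ⊂? C) ×-dec (v ∈? D)))
  ... | yes (D , sD , D⊂C , v∈D) = ∈⋃children sD D⊂C v∈D
  ... | no none = ⊥-elim (¬private (v∈C , λ D sD D⊂C v∈D → none (D , sD , D⊂C , v∈D)))

  -- Without a private element C would be covered by its children, hence lie inside one of them.
  private-exists : ∀ {C} → S C ≡ true → ∃ (Private C)
  private-exists {C} sC with Fin.any? (λ v → (v ∈? C) ×-dec ¬? (v ∈? ⋃ (children C)))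
  ... | yes (v , v∈C , v∉⋃) = v , v∈C , λ D sD D⊂C v∈D → v∉⋃ (∈⋃children sD D⊂C v∈D)
  ... | no none =
    let D , D∈ , C⊆D = block-inside-member (children C) children-members children-pairwise (blocks C sC)
                         λ {v} v∈C → decidable-stable (v ∈? ⋃ (children C)) λ v∉ → none (v , v∈C , v∉)
        _ , x , x∈C , x∉D = children-⊂ D∈
    in ⊥-elim (x∉D (C⊆D x∈C))

  -- For the parent Q of C in S, private elements of C and of Q lie in the same members of S, except C.
  module _ {C Q vC vQ} (sC : S C ≡ true) (Q-parent : Minimal (strictlyAbove C) Q)
           (vC-private : Private C vC) (vQ-private : Private Q vQ) where

    private
      sQ : S Q ≡ true
      sQ = proj₁ (strictlyAbove⁻ {C} (proj₁ Q-parent))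
      C⊂Q : C ⊂ Q
      C⊂Q = proj₂ (strictlyAbove⁻ {C} (proj₁ Q-parent))

    vQ∉C : vQ ∉ C
    vQ∉C = proj₂ vQ-private C sC C⊂Q

    private-of-C⇒private-of-Q : ∀ {D} → S D ≡ true → D ≢ C → vC ∈ D → vQ ∈ D
    private-of-C⇒private-of-Q {D} sD D≢C vC∈D with laminar D C sD sC
    ... | inj₁ D⊆C = ⊥-elim (proj₂ vC-private D sD (⊆∧≢⇒⊂ D⊆C D≢C) vC∈D)
    ... | inj₂ (inj₂ D∩C) = ⊥-elim (Disjoint⇒∉ D∩C vC∈D (proj₁ vC-private))
    ... | inj₂ (inj₁ C⊆D) with laminar D Q sD sQ
    ...   | inj₁ D⊆Q = subst (vQ ∈_) (sym (proj₂ Q-parent D (strictlyAbove⁺ sD (⊆∧≢⇒⊃ C⊆D D≢C)) D⊆Q))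
                                       (proj₁ vQ-private)
    ...   | inj₂ (inj₁ Q⊆D) = Q⊆D (proj₁ vQ-private)
    ...   | inj₂ (inj₂ D∩Q) = ⊥-elim (Disjoint⇒∉ D∩Q vC∈D (proj₁ C⊂Q (proj₁ vC-private)))

    private-of-Q⇒private-of-C : ∀ {D} → S D ≡ true → vQ ∈ D → vC ∈ D
    private-of-Q⇒private-of-C {D} sD vQ∈D with laminar D Q sD sQ
    ... | inj₂ (inj₁ Q⊆D) = Q⊆D (proj₁ C⊂Q (proj₁ vC-private))
    ... | inj₂ (inj₂ D∩Q) = ⊥-elim (Disjoint⇒∉ D∩Q vQ∈D (proj₁ vQ-private))
    ... | inj₁ D⊆Q with ≡-dec Bool._≟_ D Q
    ...   | yes refl = proj₁ C⊂Q (proj₁ vC-private)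
    ...   | no D≢Q = ⊥-elim (proj₂ vQ-private D sD (⊆∧≢⇒⊂ D⊆Q D≢Q) vQ∈D)

module MaximalNested {𝓑 : Family n} (bs : IsBuildingSet 𝓑) {N : Family n} (mx : IsMaxNested 𝓑 N) where
  open BuildingSet 𝓑 bs
  open IsNested (proj₁ mx)
  open Nested bs (proj₁ mx)

  insert : Subset n → Family n
  insert X C = N C ∨ (C == X)

  insert⁻ : ∀ {X C} → insert X C ≡ true → C ≡ X ⊎ N C ≡ true
  insert⁻ h = [ inj₂ , inj₁ ∘ ==⇒≡ ]′ (∨⁻ h)

  insert-around : ∀ {X} {L : List (Subset n)} → All (λ C → insert X C ≡ true) L →
    AllPairs Disjoint L → X ∈ₗ L → All (λ C → C ≡ X ⊎ (N C ≡ true × Disjoint C X)) L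
  insert-around {X} all pairwise X∈L = All.tabulate λ {C} C∈L →
    [ inj₁ , (λ nC → [ inj₁ , (λ C≢X → inj₂ (nC , distinct⇒Disjoint pairwise C∈L X∈L C≢X)) ]′
                      (toSum (≡-dec Bool._≟_ C X))) ]′ (insert⁻ (All.lookup all C∈L))

  member-by-insertion : ∀ {X} → 𝓑 X ≡ true → (∀ C → N C ≡ true → Laminar C X) →
    (∀ L → 2 ℕ.≤ length L → All (λ C → insert X C ≡ true) L → AllPairs Disjoint L → X ∈ₗ L →
       𝓑 (⋃ L) ≢ true) →
    N X ≡ true
  member-by-insertion {X} bX laminar-X no-union-X =
    proj₂ mx (insert X) nested (λ _ → ∨⁺ˡ) X (∨⁺ʳ {a = N X} (==-refl {C = X}))
    where
    laminar⁺ : ∀ C D → insert X C ≡ true → insert X D ≡ true → Laminar C D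
    laminar⁺ C D iC iD with insert⁻ iC | insert⁻ iD
    ... | inj₁ refl | inj₁ refl = inj₁ ⊆-refl
    ... | inj₁ refl | inj₂ nD = Laminar-sym (laminar-X D nD)
    ... | inj₂ nC | inj₁ refl = laminar-X C nC
    ... | inj₂ nC | inj₂ nD = laminar C D nC nD
    noUnion⁺ : ∀ L → length L ≥ 2 → All (λ C → insert X C ≡ true) L → AllPairs Disjoint L → 𝓑 (⋃ L) ≡ false
    noUnion⁺ L two all pairwise with any? (≡-dec Bool._≟_ X) L
    ... | yes X∈L = ¬-not (no-union-X L two all pairwise X∈L)
    ... | no X∉L = noUnion L two (All.tabulate old) pairwise
      where
      old : ∀ {C} → C ∈ₗ L → N C ≡ true
      old C∈L = [ (λ { refl → ⊥-elim (X∉L C∈L) }) , (λ nC → nC) ]′ (insert⁻ (All.lookup all C∈L))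
    nested : IsNested 𝓑 (insert X)
    nested = record
      { blocks = λ C iC → [ (λ { refl → bX }) , blocks C ]′ (insert⁻ iC)
      ; laminar = laminar⁺
      ; noUnion = noUnion⁺
      ; maxBlocks = λ K κK → ∨⁺ˡ (maxBlocks K κK)
      }

  insert-blocks : ∀ {X} {L : List (Subset n)} → 𝓑 X ≡ true → All (λ C → insert X C ≡ true) L →
    All (λ C → 𝓑 C ≡ true) L
  insert-blocks bX = All.map λ iC → [ (λ { refl → bX }) , blocks _ ]′ (insert⁻ iC)

  -- Two private elements u ≠ w of C would let the block of κ(C ─ ⁅ u ⁆) around w join N.
  private-unique : ∀ {C u w} → N C ≡ true → Private C u → Private C w → u ≡ w
  private-unique {C} {u} {w} nC (u∈C , u-private) (w∈C , w-private) =
    decidable-stable (u Fin.≟ w) λ u≢w →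
      let X , κX , w∈X = InKappa-covers (∈U w∈C (u≢w ∘ sym))
      in w-private X (X∈N κX w∈X) (X⊂C κX) w∈X
    where
    U : Subset n
    U = C ─ ⁅ u ⁆
    ∈U : ∀ {x} → x ∈ C → x ≢ u → x ∈ U
    ∈U x∈C x≢u = x∈p∧x∉q⇒x∈p─q x∈C (x≢y⇒x∉⁅y⁆ x≢u)
    X⊂C : ∀ {X} → InKappa 𝓑 U X → X ⊂ C
    X⊂C (_ , X⊆U , _) = p─q⊆p C ⁅ u ⁆ ∘ X⊆U , u , u∈C , λ u∈X → x∈p─q⇒x∉q C ⁅ u ⁆ (X⊆U u∈X) (x∈⁅x⁆ u)
    member-⊂C⇒⊆U : ∀ {D} → N D ≡ true → D ⊂ C → D ⊆ U
    member-⊂C⇒⊆U nD D⊂C x∈D = ∈U (proj₁ D⊂C x∈D) λ { refl → u-private _ nD D⊂C x∈D }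
    X∈N : ∀ {X} → InKappa 𝓑 U X → w ∈ X → N X ≡ true
    X∈N {X} κX w∈X = member-by-insertion (proj₁ κX) laminar-X no-union-X
      where
      laminar-X : ∀ D → N D ≡ true → Laminar D X
      laminar-X D nD with laminar D C nD nC
      ... | inj₂ (inj₁ C⊆D) = inj₂ (inj₁ (C⊆D ∘ proj₁ (X⊂C κX)))
      ... | inj₂ (inj₂ D∩C) = inj₂ (inj₂ (∉⇒Disjoint λ x∈D x∈X → Disjoint⇒∉ D∩C x∈D (proj₁ (X⊂C κX) x∈X)))
      ... | inj₁ D⊆C with ≡-dec Bool._≟_ D C | nonempty? (D ∩ X)
      ...   | yes refl | _ = inj₂ (inj₁ (proj₁ (X⊂C κX)))
      ...   | no D≢C | yes D∩X = inj₁ (InKappa-absorbs κX (blocks D nD) (member-⊂C⇒⊆U nD (⊆∧≢⇒⊂ D⊆C D≢C)) D∩X)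
      ...   | no _ | no D∩X = inj₂ (inj₂ D∩X)
      ⋃⊆U : ∀ L → All (λ C → C ≡ X ⊎ (N C ≡ true × Disjoint C X)) L → ⋃ L ⊆ C → ⋃ L ⊆ U
      ⋃⊆U L around ⋃L⊆C = ⋃⊆ L (All.tabulate λ {D} D∈L → [ (λ { refl → proj₁ (proj₂ κX) }) ,
        (λ (nD , D∩X) → member-⊂C⇒⊆U nD (⊆∧≢⇒⊂ (⋃L⊆C ∘ ⋃⁺ L D∈L)
                                              λ { refl → Disjoint⇒∉ D∩X w∈C w∈X })) ]′ (All.lookup around D∈L))
      no-union-X : ∀ L → 2 ℕ.≤ length L → All (λ C → insert X C ≡ true) L → AllPairs Disjoint L →
        X ∈ₗ L → 𝓑 (⋃ L) ≢ true
      no-union-X L two all pairwise X∈L b⋃L =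
        let around = insert-around all pairwise X∈L
            ⋃L⊆C = ⋃⊆member-around nC (proj₁ (X⊂C κX)) (w , w∈X) pairwise b⋃L X∈L around
        in InKappa-unsplittable κX pairwise two X∈L (insert-blocks (proj₁ κX) all) b⋃L (⋃⊆U L around ⋃L⊆C)

-- The combinatorics of an exchange

module Exchange {𝓑 : Family n} (bs : IsBuildingSet 𝓑) {N N′ : Family n}
  (mxN : IsMaxNested 𝓑 N) (mxN′ : IsMaxNested 𝓑 N′) {B B′ P : Subset n}
  (nB : N B ≡ true) (nB′ : N′ B′ ≡ true) (B≢B′ : B ≢ B′)
  (exchange : ∀ C → (N C ∧ not (C == B)) ≡ (N′ C ∧ not (C == B′)))
  (parent : IsParent N B P) where

  open BuildingSet 𝓑 bs
  module N = IsNested (proj₁ mxN)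
  module N′ = IsNested (proj₁ mxN′)
  open MaximalNested bs mxN
  open Nested bs (proj₁ mxN)
  module Nested′ = Nested bs (proj₁ mxN′)

  N⇒N′ : ∀ {C} → N C ≡ true → C ≢ B → N′ C ≡ true
  N⇒N′ {C} nC C≢B = ∧⁻ˡ (trans (sym (exchange C)) (∧-not⁺ nC (≢⇒== C≢B)))

  B′∉N : N B′ ≢ true
  B′∉N nB′∈N = true≢false (trans (sym (exchange B′)) (∧-not⁺ nB′∈N (≢⇒== (B≢B′ ∘ sym))))
                          (∧-not-true (==-refl {C = B′}))

  N′⇒N : ∀ {C} → N′ C ≡ true → C ≢ B′ → N C ≡ true
  N′⇒N {C} nC C≢B′ = ∧⁻ˡ (trans (exchange C) (∧-not⁺ nC (≢⇒== C≢B′)))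

  nP : N P ≡ true
  nP = proj₁ parent

  B⊂P : B ⊂ P
  B⊂P = proj₁ (proj₂ parent)

  nP′ : N′ P ≡ true
  nP′ = N⇒N′ nP (⊂⇒≢ B⊂P ∘ sym)

  bB : 𝓑 B ≡ true
  bB = N.blocks B nB

  bB′ : 𝓑 B′ ≡ true
  bB′ = N′.blocks B′ nB′

  neB : Nonempty B
  neB = nonempty B bB

  neB′ : Nonempty B′
  neB′ = nonempty B′ bB′

  around-B : ∀ {L} → All (λ C → insert B′ C ≡ true) L → AllPairs Disjoint L → B ∈ₗ L →
    All (λ C → C ≡ B ⊎ (N′ C ≡ true × Disjoint C B)) L
  around-B all pairwise B∈L = All.tabulate λ {C} C∈L →
    [ inj₁ , (λ C≢B → inj₂ ( [ (λ { refl → nB′ }) , (λ nC → N⇒N′ nC C≢B) ]′ (insert⁻ (All.lookup all C∈L))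
                           , distinct⇒Disjoint pairwise C∈L B∈L C≢B)) ]′ (toSum (≡-dec Bool._≟_ C B))

  B′-not-insertable : Laminar B B′ →
    (∀ L → All (λ C → insert B′ C ≡ true) L → AllPairs Disjoint L → B ∈ₗ L → B′ ∈ₗ L → 𝓑 (⋃ L) ≢ true) →
    Void
  B′-not-insertable laminar-BB′ no-union = B′∉N (member-by-insertion bB′ laminar-B′ no-union-B′)
    where
    laminar-B′ : ∀ C → N C ≡ true → Laminar C B′
    laminar-B′ C nC with ≡-dec Bool._≟_ C B
    ... | yes refl = laminar-BB′
    ... | no C≢B = N′.laminar C B′ (N⇒N′ nC C≢B) nB′
    no-union-B′ : ∀ L → 2 ℕ.≤ length L → All (λ C → insert B′ C ≡ true) L → AllPairs Disjoint L →
      B′ ∈ₗ L → 𝓑 (⋃ L) ≢ true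
    no-union-B′ L two all pairwise B′∈L with any? (≡-dec Bool._≟_ B) L
    ... | yes B∈L = no-union L all pairwise B∈L B′∈L
    ... | no B∉L = λ b⋃L → true≢false b⋃L (N′.noUnion L two (All.tabulate in-N′) pairwise)
      where
      in-N′ : ∀ {C} → C ∈ₗ L → N′ C ≡ true
      in-N′ C∈L = [ (λ { refl → nB′ }) , (λ nC → N⇒N′ nC λ { refl → B∉L C∈L }) ]′ (insert⁻ (All.lookup all C∈L))

  B⊈B′ : ¬ B ⊆ B′
  B⊈B′ B⊆B′ = B′-not-insertable (inj₁ B⊆B′) λ L _ pairwise B∈L B′∈L _ →
    Nonempty⇒¬Disjoint neB B⊆B′ (distinct⇒Disjoint pairwise B∈L B′∈L B≢B′)

  B′⊈B : ¬ B′ ⊆ B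
  B′⊈B B′⊆B = B′-not-insertable (inj₂ (inj₁ B′⊆B)) λ L _ pairwise B∈L B′∈L _ →
    Nonempty⇒¬Disjoint neB′ B′⊆B (distinct⇒Disjoint pairwise B′∈L B∈L (B≢B′ ∘ sym))

  B′-meets-P : ¬ Disjoint B′ P
  B′-meets-P B′∩P = B′-not-insertable (inj₂ (inj₂ B∩B′)) λ L all pairwise B∈L B′∈L b⋃L →
    let ⋃L⊆P = Nested′.⋃⊆member-around nP′ (proj₁ B⊂P) neB pairwise b⋃L B∈L (around-B all pairwise B∈L)
    in Nonempty⇒¬Disjoint neB′ (⋃L⊆P ∘ ⋃⁺ L B′∈L) B′∩P
    where
    B∩B′ : Disjoint B B′
    B∩B′ = ∉⇒Disjoint λ x∈B x∈B′ → Disjoint⇒∉ B′∩P x∈B′ (proj₁ B⊂P x∈B)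

  B′⊆P : B′ ⊆ P
  B′⊆P with N′.laminar B′ P nB′ nP′
  ... | inj₁ B′⊆P = B′⊆P
  ... | inj₂ (inj₁ P⊆B′) = ⊥-elim (B⊈B′ (P⊆B′ ∘ proj₁ B⊂P))
  ... | inj₂ (inj₂ B′∩P) = ⊥-elim (B′-meets-P B′∩P)

  B′⊆member⇒meets-B : ∀ {D} → N D ≡ true → B′ ⊆ D → ¬ Disjoint D B
  B′⊆member⇒meets-B {D} nD B′⊆D D∩B = B′-not-insertable (inj₂ (inj₂ B∩B′)) λ L all pairwise B∈L B′∈L b⋃L →
    let ⋃L⊆D = ⋃⊆member-around nD B′⊆D neB′ pairwise b⋃L B′∈L (insert-around all pairwise B′∈L)
    in Nonempty⇒¬Disjoint neB (⋃L⊆D ∘ ⋃⁺ L B∈L) (Disjoint-sym D∩B)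
    where
    B∩B′ : Disjoint B B′
    B∩B′ = ∉⇒Disjoint λ x∈B x∈B′ → Disjoint⇒∉ D∩B (B′⊆D x∈B′) x∈B

  member-⊂P : ∀ {D} → N D ≡ true → D ⊂ P → D ⊆ B ⊎ Disjoint D B
  member-⊂P {D} nD D⊂P with N.laminar D B nD nB
  ... | inj₁ D⊆B = inj₁ D⊆B
  ... | inj₂ (inj₂ D∩B) = inj₂ D∩B
  ... | inj₂ (inj₁ B⊆D) with ≡-dec Bool._≟_ D B
  ...   | yes refl = inj₁ ⊆-refl
  ...   | no D≢B = ⊥-elim (proj₂ (proj₂ parent) D nD (⊆∧≢⇒⊃ B⊆D D≢B) D⊂P)

  ∈P─B∪B′⁻ : ∀ {x} → x ∈ P ─ (B ∪ B′) → x ∈ P × x ∉ B × x ∉ B′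
  ∈P─B∪B′⁻ m = let x∉B∪B′ = x∈p─q⇒x∉q P (B ∪ B′) m
               in p─q⊆p P (B ∪ B′) m , x∉B∪B′ ∘ ∈-∪ˡ , x∉B∪B′ ∘ ∈-∪ʳ {A = B}

  ∈P─B∪B′⁺ : ∀ {x} → x ∈ P → x ∉ B → x ∉ B′ → x ∈ P ─ (B ∪ B′)
  ∈P─B∪B′⁺ x∈P x∉B x∉B′ = x∈p∧x∉q⇒x∈p─q x∈P ([ x∉B , x∉B′ ]′ ∘ x∈p∪q⁻ B B′)

  module _ {p : Fin n} (p-private : Private P p) where

    ∈⋃children-P : ∀ {v} → v ∈ P → v ≢ p → v ∈ ⋃ (children P)
    ∈⋃children-P v∈P v≢p = ¬Private⇒∈⋃children v∈P λ v-private → v≢p (private-unique nP v-private p-private)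

    -- The child of P containing B′ would have to lie in B or be disjoint from it.
    private∈B′ : p ∈ B′
    private∈B′ = decidable-stable (p ∈? B′) λ p∉B′ →
      let D , D∈ , B′⊆D = block-inside-member (children P) children-members children-pairwise bB′
                             λ x∈B′ → ∈⋃children-P (B′⊆P x∈B′) λ { refl → p∉B′ x∈B′ }
          nD = All.lookup children-members D∈
      in [ (λ D⊆B → B′⊈B λ x∈B′ → D⊆B (B′⊆D x∈B′)) , B′⊆member⇒meets-B nD B′⊆D ]′ (member-⊂P nD (children-⊂ D∈))

    -- K lies in a child D of P (the only element of P missing from the children is p ∈ B′),
    -- and D avoids B and B′, so maximality of K forces K = D.
    κ[P─B∪B′]⊆N′ : ∀ {K} → InKappa 𝓑 (P ─ (B ∪ B′)) K → N K ≡ true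
    κ[P─B∪B′]⊆N′ {K} (bK , K⊆U , max) with block-inside-member (children P) children-members children-pairwise bK K⊆⋃
      where
      K⊆⋃ : K ⊆ ⋃ (children P)
      K⊆⋃ x∈K with ∈P─B∪B′⁻ (K⊆U x∈K)
      ... | x∈P , _ , x∉B′ = ∈⋃children-P x∈P λ { refl → x∉B′ private∈B′ }
    ... | D , D∈ , K⊆D = subst (λ Z → N Z ≡ true) (max D (N.blocks D nD) K⊆D D⊆U) nD
      where
      nD : N D ≡ true
      nD = All.lookup children-members D∈
      x∈K : proj₁ (nonempty K bK) ∈ K
      x∈K = proj₂ (nonempty K bK)
      D∩B : Disjoint D B
      D∩B with member-⊂P nD (children-⊂ D∈)
      ... | inj₁ D⊆B = ⊥-elim (proj₁ (proj₂ (∈P─B∪B′⁻ (K⊆U x∈K))) (D⊆B (K⊆D x∈K)))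
      ... | inj₂ D∩B = D∩B
      D∩B′ : Disjoint D B′
      D∩B′ with N′.laminar D B′ (N⇒N′ nD λ { refl → Nonempty⇒¬Disjoint neB ⊆-refl D∩B }) nB′
      ... | inj₁ D⊆B′ = ⊥-elim (proj₂ (proj₂ (∈P─B∪B′⁻ (K⊆U x∈K))) (D⊆B′ (K⊆D x∈K)))
      ... | inj₂ (inj₁ B′⊆D) = ⊥-elim (B′⊆member⇒meets-B nD B′⊆D D∩B)
      ... | inj₂ (inj₂ D∩B′) = D∩B′
      D⊆U : D ⊆ P ─ (B ∪ B′)
      D⊆U y∈D = ∈P─B∪B′⁺ (proj₁ (children-⊂ D∈) y∈D) (Disjoint⇒∉ D∩B y∈D) (Disjoint⇒∉ D∩B′ y∈D)

  κ[P─B∪B′]⊆N : ∀ {K} → InKappa 𝓑 (P ─ (B ∪ B′)) K → N K ≡ true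
  κ[P─B∪B′]⊆N = κ[P─B∪B′]⊆N′ (proj₂ (private-exists nP))

  κ[B∩B′]⊆N : ∀ {X} → InKappa 𝓑 (B ∩ B′) X → N X ≡ true
  κ[B∩B′]⊆N {X} κX@(bX , X⊆B∩B′ , _) = member-by-insertion bX laminar-X no-union-X
    where
    neX : Nonempty X
    neX = nonempty X bX
    X⊆B : X ⊆ B
    X⊆B = p∩q⊆p B B′ ∘ X⊆B∩B′
    X⊆B′ : X ⊆ B′
    X⊆B′ = p∩q⊆q B B′ ∘ X⊆B∩B′
    laminar-X : ∀ D → N D ≡ true → Laminar D X
    laminar-X D nD with ≡-dec Bool._≟_ D B
    ... | yes refl = inj₂ (inj₁ X⊆B)
    ... | no D≢B with N.laminar D B nD nB | N′.laminar D B′ (N⇒N′ nD D≢B) nB′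
    ...   | inj₂ (inj₁ B⊆D) | _ = inj₂ (inj₁ (B⊆D ∘ X⊆B))
    ...   | inj₂ (inj₂ D∩B) | _ = inj₂ (inj₂ (∉⇒Disjoint λ x∈D x∈X → Disjoint⇒∉ D∩B x∈D (X⊆B x∈X)))
    ...   | inj₁ _ | inj₂ (inj₁ B′⊆D) = inj₂ (inj₁ (B′⊆D ∘ X⊆B′))
    ...   | inj₁ _ | inj₂ (inj₂ D∩B′) = inj₂ (inj₂ (∉⇒Disjoint λ x∈D x∈X → Disjoint⇒∉ D∩B′ x∈D (X⊆B′ x∈X)))
    ...   | inj₁ D⊆B | inj₁ D⊆B′ with nonempty? (D ∩ X)
    ...     | yes D∩X = inj₁ (InKappa-absorbs κX (N.blocks D nD) (λ x∈D → x∈p∩q⁺ (D⊆B x∈D , D⊆B′ x∈D)) D∩X)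
    ...     | no D∩X = inj₂ (inj₂ D∩X)
    around′ : ∀ {C} → C ≡ X ⊎ (N C ≡ true × Disjoint C X) → C ≡ X ⊎ (N′ C ≡ true × Disjoint C X)
    around′ (inj₁ C≡X) = inj₁ C≡X
    around′ (inj₂ (nC , C∩X)) =
      inj₂ (N⇒N′ nC (λ { refl → Nonempty⇒¬Disjoint neX X⊆B (Disjoint-sym C∩X) }) , C∩X)
    no-union-X : ∀ L → 2 ℕ.≤ length L → All (λ C → insert X C ≡ true) L → AllPairs Disjoint L →
      X ∈ₗ L → 𝓑 (⋃ L) ≢ true
    no-union-X L two all pairwise X∈L b⋃L =
      InKappa-unsplittable κX pairwise two X∈L (insert-blocks bX all) b⋃L
        (λ x∈⋃L → x∈p∩q⁺ (⋃L⊆B x∈⋃L , ⋃L⊆B′ x∈⋃L))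
      where
      around : All (λ C → C ≡ X ⊎ (N C ≡ true × Disjoint C X)) L
      around = insert-around all pairwise X∈L
      ⋃L⊆B : ⋃ L ⊆ B
      ⋃L⊆B = ⋃⊆member-around nB X⊆B neX pairwise b⋃L X∈L around
      ⋃L⊆B′ : ⋃ L ⊆ B′
      ⋃L⊆B′ = Nested′.⋃⊆member-around nB′ X⊆B′ neX pairwise b⋃L X∈L (All.map around′ around)

*-self-nonNeg : ∀ a → 0ℚ ≤ a * a
*-self-nonNeg a with ℚ.<-cmp a 0ℚ
... | tri< a<0 _ _ = ℚ.<⇒≤ (ℚ.positive⁻¹ (a * a) {{ℚ.neg*neg⇒pos a {{negative a<0}} a {{negative a<0}}}})
... | tri≈ _ refl _ = ℚ.≤-refl
... | tri> _ _ a>0 = ℚ.<⇒≤ (ℚ.positive⁻¹ (a * a) {{ℚ.pos*pos⇒pos a {{positive a>0}} a {{positive a>0}}}})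

*-self≡0⇒≡0 : ∀ a → a * a ≡ 0ℚ → a ≡ 0ℚ
*-self≡0⇒≡0 a aa≡0 with ℚ.<-cmp a 0ℚ
... | tri< a<0 _ _ = ⊥-elim (ℚ.<-irrefl (sym aa≡0)
      (ℚ.positive⁻¹ (a * a) {{ℚ.neg*neg⇒pos a {{negative a<0}} a {{negative a<0}}}}))
... | tri≈ _ a≡0 _ = a≡0
... | tri> _ _ a>0 = ⊥-elim (ℚ.<-irrefl (sym aa≡0)
      (ℚ.positive⁻¹ (a * a) {{ℚ.pos*pos⇒pos a {{positive a>0}} a {{positive a>0}}}}))

nonNeg+nonNeg≡0⇒≡0 : ∀ {a b} → 0ℚ ≤ a → 0ℚ ≤ b → a + b ≡ 0ℚ → a ≡ 0ℚ × b ≡ 0ℚ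
nonNeg+nonNeg≡0⇒≡0 {a} {b} 0≤a 0≤b a+b≡0 = ℚ.≤-antisym a≤0 0≤a , ℚ.≤-antisym b≤0 0≤b
  where
  a≤0 : a ≤ 0ℚ
  a≤0 = subst₂ _≤_ (ℚ.+-identityʳ a) a+b≡0 (ℚ.+-monoʳ-≤ a 0≤b)
  b≤0 : b ≤ 0ℚ
  b≤0 = subst₂ _≤_ (ℚ.+-identityˡ b) a+b≡0 (ℚ.+-monoˡ-≤ b 0≤a)

x-y-z≡0⇒x≡y+z : ∀ {x y z} → x - y - z ≡ 0ℚ → x ≡ y + z
x-y-z≡0⇒x≡y+z {x} {y} {z} x-y-z≡0 = p-q≡0⇒p≡q x (y + z)
  (trans (solve 3 (λ x y z → x :- (y :+ z) := x :- y :- z) refl x y z) x-y-z≡0)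

∑-cong : ∀ {f g : Fin n → ℚ} → (∀ v → f v ≡ g v) → ∑ f ≡ ∑ g
∑-cong {zero} _ = refl
∑-cong {suc n} f≗g = cong₂ _+_ (f≗g Fin.zero) (∑-cong (f≗g ∘ Fin.suc))

∑-zero : ∀ (f : Fin n → ℚ) → (∀ v → f v ≡ 0ℚ) → ∑ f ≡ 0ℚ
∑-zero {zero} _ _ = refl
∑-zero {suc n} f f≗0 = trans (cong₂ _+_ (f≗0 Fin.zero) (∑-zero _ (f≗0 ∘ Fin.suc))) (ℚ.+-identityˡ 0ℚ)

∑-distrib-+ : ∀ (f g : Fin n → ℚ) → ∑ (λ v → f v + g v) ≡ ∑ f + ∑ g
∑-distrib-+ {zero} _ _ = refl
∑-distrib-+ {suc n} f g = trans (cong (f Fin.zero + g Fin.zero +_) (∑-distrib-+ (f ∘ Fin.suc) (g ∘ Fin.suc)))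
  (+-interchange (f Fin.zero) (g Fin.zero) (∑ (f ∘ Fin.suc)) (∑ (g ∘ Fin.suc)))

*-distribˡ-∑ : ∀ (c : ℚ) (f : Fin n → ℚ) → ∑ (λ v → c * f v) ≡ c * ∑ f
*-distribˡ-∑ {zero} c _ = sym (ℚ.*-zeroʳ c)
*-distribˡ-∑ {suc n} c f =
  trans (cong (c * f Fin.zero +_) (*-distribˡ-∑ c (f ∘ Fin.suc))) (sym (ℚ.*-distribˡ-+ c _ _))

∑-neg : ∀ (f : Fin n → ℚ) → ∑ (λ v → - f v) ≡ - ∑ f
∑-neg {zero} _ = refl
∑-neg {suc n} f = trans (cong (- f Fin.zero +_) (∑-neg (f ∘ Fin.suc)))
  (sym (ℚ.neg-distrib-+ (f Fin.zero) (∑ (f ∘ Fin.suc))))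

∑-distrib-- : ∀ (f g : Fin n → ℚ) → ∑ (λ v → f v - g v) ≡ ∑ f - ∑ g
∑-distrib-- f g = trans (∑-distrib-+ f (-_ ∘ g)) (cong (∑ f +_) (∑-neg g))

∑-sq-nonNeg : ∀ (x : Fin n → ℚ) → 0ℚ ≤ ∑ (λ v → x v * x v)
∑-sq-nonNeg {zero} _ = ℚ.≤-refl
∑-sq-nonNeg {suc n} x = subst (_≤ ∑ (λ v → x v * x v)) (ℚ.+-identityˡ 0ℚ)
  (ℚ.+-mono-≤ (*-self-nonNeg (x Fin.zero)) (∑-sq-nonNeg (x ∘ Fin.suc)))

∑-sq≡0⇒≡0 : ∀ (x : Fin n → ℚ) → ∑ (λ v → x v * x v) ≡ 0ℚ → ∀ v → x v ≡ 0ℚ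
∑-sq≡0⇒≡0 {suc n} x ∑≡0 = λ where
    Fin.zero → *-self≡0⇒≡0 (x Fin.zero) (proj₁ head∧tail≡0)
    (Fin.suc v) → ∑-sq≡0⇒≡0 (x ∘ Fin.suc) (proj₂ head∧tail≡0) v
  where
  head∧tail≡0 : x Fin.zero * x Fin.zero ≡ 0ℚ × ∑ (λ v → x (Fin.suc v) * x (Fin.suc v)) ≡ 0ℚ
  head∧tail≡0 = nonNeg+nonNeg≡0⇒≡0 (*-self-nonNeg (x Fin.zero)) (∑-sq-nonNeg (x ∘ Fin.suc)) ∑≡0

δ : Fin n → Fin n → ℚ
δ v u = if does (u Fin.≟ v) then 1ℚ else 0ℚ

∑-*δ : ∀ (f : Fin n → ℚ) (v : Fin n) → ∑ (λ u → f u * δ v u) ≡ f v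
∑-*δ {suc n} f Fin.zero =
  trans (cong₂ _+_ (ℚ.*-identityʳ (f Fin.zero)) (∑-zero _ λ u → ℚ.*-zeroʳ (f (Fin.suc u))))
        (ℚ.+-identityʳ (f Fin.zero))
∑-*δ {suc n} f (Fin.suc v) =
  trans (cong₂ _+_ (ℚ.*-zeroʳ (f Fin.zero)) (∑-cong shift))
        (trans (ℚ.+-identityˡ _) (∑-*δ (f ∘ Fin.suc) v))
  where
  shift : ∀ u → f (Fin.suc u) * δ (Fin.suc v) (Fin.suc u) ≡ f (Fin.suc u) * δ v u
  shift u with u Fin.≟ v
  ... | yes _ = refl
  ... | no _ = refl

sumSub-cong : ∀ {f g : Subset n → ℚ} → (∀ C → f C ≡ g C) → sumSub f ≡ sumSub g
sumSub-cong {zero} f≗g = f≗g []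
sumSub-cong {suc n} f≗g = cong₂ _+_ (sumSub-cong (f≗g ∘ (outside ∷_))) (sumSub-cong (f≗g ∘ (inside ∷_)))

sumSub-zero : ∀ (f : Subset n → ℚ) → (∀ C → f C ≡ 0ℚ) → sumSub f ≡ 0ℚ
sumSub-zero {zero} f f≗0 = f≗0 []
sumSub-zero {suc n} f f≗0 =
  trans (cong₂ _+_ (sumSub-zero _ (f≗0 ∘ (outside ∷_))) (sumSub-zero _ (f≗0 ∘ (inside ∷_)))) (ℚ.+-identityˡ 0ℚ)

sumSub-distrib-+ : ∀ (f g : Subset n → ℚ) → sumSub (λ C → f C + g C) ≡ sumSub f + sumSub g
sumSub-distrib-+ {zero} _ _ = refl
sumSub-distrib-+ {suc n} f g = trans
  (cong₂ _+_ (sumSub-distrib-+ (f ∘ (outside ∷_)) (g ∘ (outside ∷_)))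
             (sumSub-distrib-+ (f ∘ (inside ∷_)) (g ∘ (inside ∷_))))
  (+-interchange (sumSub (f ∘ (outside ∷_))) (sumSub (g ∘ (outside ∷_)))
                 (sumSub (f ∘ (inside ∷_))) (sumSub (g ∘ (inside ∷_))))

*-distribˡ-sumSub : ∀ (c : ℚ) (f : Subset n → ℚ) → sumSub (λ C → c * f C) ≡ c * sumSub f
*-distribˡ-sumSub {zero} _ _ = refl
*-distribˡ-sumSub {suc n} c f = trans
  (cong₂ _+_ (*-distribˡ-sumSub c (f ∘ (outside ∷_))) (*-distribˡ-sumSub c (f ∘ (inside ∷_))))
  (sym (ℚ.*-distribˡ-+ c _ _))

sumSub-neg : ∀ (f : Subset n → ℚ) → sumSub (λ C → - f C) ≡ - sumSub f
sumSub-neg {zero} _ = refl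
sumSub-neg {suc n} f = trans (cong₂ _+_ (sumSub-neg (f ∘ (outside ∷_))) (sumSub-neg (f ∘ (inside ∷_))))
  (sym (ℚ.neg-distrib-+ (sumSub (f ∘ (outside ∷_))) (sumSub (f ∘ (inside ∷_)))))

sumSub-distrib-- : ∀ (f g : Subset n → ℚ) → sumSub (λ C → f C - g C) ≡ sumSub f - sumSub g
sumSub-distrib-- f g = trans (sumSub-distrib-+ f (-_ ∘ g)) (cong (sumSub f +_) (sumSub-neg g))

sumSub-single : ∀ (f : Subset n → ℚ) (X : Subset n) → (∀ C → C ≢ X → f C ≡ 0ℚ) → sumSub f ≡ f X
sumSub-single {zero} f [] _ = refl
sumSub-single {suc n} f (false ∷ X) off = trans
  (cong₂ _+_ (sumSub-single (f ∘ (outside ∷_)) X (λ C C≢X → off _ (C≢X ∘ cong Vec.tail)))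
             (sumSub-zero (f ∘ (inside ∷_)) (λ C → off _ λ ())))
  (ℚ.+-identityʳ _)
sumSub-single {suc n} f (true ∷ X) off = trans
  (cong₂ _+_ (sumSub-zero (f ∘ (outside ∷_)) (λ C → off _ λ ()))
             (sumSub-single (f ∘ (inside ∷_)) X (λ C C≢X → off _ (C≢X ∘ cong Vec.tail))))
  (ℚ.+-identityˡ _)

sumSub-[==] : ∀ (X : Subset n) (f : Subset n → ℚ) → sumSub (λ C → [ C == X ]ℚ * f C) ≡ f X
sumSub-[==] X f = trans (sumSub-single _ X off)
  (trans (cong (λ b → [ b ]ℚ * f X) (==-refl {C = X})) (ℚ.*-identityˡ (f X)))
  where
  off : ∀ C → C ≢ X → [ C == X ]ℚ * f C ≡ 0ℚ
  off C C≢X = trans (cong (λ b → [ b ]ℚ * f C) (≢⇒== C≢X)) (ℚ.*-zeroˡ (f C))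

∑-sumSub-comm : ∀ {k m} (F : Subset k → Fin m → ℚ) → ∑ (λ v → sumSub (λ C → F C v)) ≡ sumSub (λ C → ∑ (F C))
∑-sumSub-comm {zero} F = refl
∑-sumSub-comm {suc k} F = trans
  (∑-distrib-+ (λ v → sumSub (λ C → F (outside ∷ C) v)) (λ v → sumSub (λ C → F (inside ∷ C) v)))
  (cong₂ _+_ (∑-sumSub-comm (F ∘ (outside ∷_))) (∑-sumSub-comm (F ∘ (inside ∷_))))

module _ {n : ℕ} where

  ind-∈ : ∀ {C : Subset n} {v} → v ∈ C → ind C v ≡ 1ℚ
  ind-∈ {C} {v} v∈C with v ∈? C
  ... | yes _ = refl
  ... | no v∉C = ⊥-elim (v∉C v∈C)

  ind-∉ : ∀ {C : Subset n} {v} → v ∉ C → ind C v ≡ 0ℚ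
  ind-∉ {C} {v} v∉C with v ∈? C
  ... | yes v∈C = ⊥-elim (v∉C v∈C)
  ... | no _ = refl

  ind-cong : ∀ (C : Subset n) {v w} → (v ∈ C → w ∈ C) → (w ∈ C → v ∈ C) → ind C v ≡ ind C w
  ind-cong C {v} v⇒w w⇒v with v ∈? C
  ... | yes v∈C = sym (ind-∈ (v⇒w v∈C))
  ... | no v∉C = sym (ind-∉ (v∉C ∘ w⇒v))

  dot-ind : ∀ (C : Subset n) x → dot (ind C) x ≡ sumOver C x
  dot-ind C x = ∑-cong pointwise
    where
    pointwise : ∀ v → ind C v * x v ≡ (if does (v ∈? C) then x v else 0ℚ)
    pointwise v with does (v ∈? C)
    ... | true = ℚ.*-identityˡ (x v)
    ... | false = ℚ.*-zeroˡ (x v)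

  dot-comm : ∀ (x y : Fin n → ℚ) → dot x y ≡ dot y x
  dot-comm x y = ∑-cong λ v → ℚ.*-comm (x v) (y v)

  dot-zeroˡ : ∀ (x y : Fin n → ℚ) → ZeroVec x → dot x y ≡ 0ℚ
  dot-zeroˡ x y x≡0 = ∑-zero _ λ v → trans (cong (_* y v) (x≡0 v)) (ℚ.*-zeroˡ (y v))

  dot-distribʳ-- : ∀ (x y h : Fin n → ℚ) → dot (λ v → x v - y v) h ≡ dot x h - dot y h
  dot-distribʳ-- x y h = trans (∑-cong pointwise) (∑-distrib-- (λ v → x v * h v) (λ v → y v * h v))
    where
    pointwise : ∀ v → (x v - y v) * h v ≡ x v * h v - y v * h v
    pointwise v = trans (ℚ.*-distribʳ-+ (h v) (x v) (- y v))
                        (cong (x v * h v +_) (sym (ℚ.neg-distribˡ-* (y v) (h v))))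

  dot-δ-δ : ∀ (x : Fin n → ℚ) v w → dot x (λ u → δ v u - δ w u) ≡ x v - x w
  dot-δ-δ x v w = trans (∑-cong pointwise)
    (trans (∑-distrib-- (λ u → x u * δ v u) (λ u → x u * δ w u)) (cong₂ _-_ (∑-*δ x v) (∑-*δ x w)))
    where
    pointwise : ∀ u → x u * (δ v u - δ w u) ≡ x u * δ v u - x u * δ w u
    pointwise u = trans (ℚ.*-distribˡ-+ (x u) (δ v u) (- δ w u))
                        (cong (x u * δ v u +_) (sym (ℚ.neg-distribʳ-* (x u) (δ w u))))

  dot-combinationˡ : ∀ (c : Subset n → ℚ) (x : Subset n → Fin n → ℚ) (y : Fin n → ℚ) →
    dot (λ v → sumSub (λ C → c C * x C v)) y ≡ sumSub (λ C → c C * dot (x C) y)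
  dot-combinationˡ c x y = begin
    ∑ (λ v → sumSub (λ C → c C * x C v) * y v)  ≡⟨ ∑-cong pull-in ⟩
    ∑ (λ v → sumSub (λ C → y v * (c C * x C v))) ≡⟨ ∑-sumSub-comm (λ C v → y v * (c C * x C v)) ⟩
    sumSub (λ C → ∑ (λ v → y v * (c C * x C v))) ≡⟨ sumSub-cong pull-out ⟩
    sumSub (λ C → c C * dot (x C) y)             ∎
    where
    open ≡-Reasoning
    pull-in : ∀ v → sumSub (λ C → c C * x C v) * y v ≡ sumSub (λ C → y v * (c C * x C v))
    pull-in v = trans (ℚ.*-comm _ (y v)) (sym (*-distribˡ-sumSub (y v) (λ C → c C * x C v)))
    pull-out : ∀ C → ∑ (λ v → y v * (c C * x C v)) ≡ c C * dot (x C) y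
    pull-out C = trans (∑-cong λ v → solve 3 (λ a b d → a :* (b :* d) := b :* (d :* a)) refl (y v) (c C) (x C v))
                       (*-distribˡ-∑ (c C) (λ v → x C v * y v))

lincomb : (Subset n → ℚ) → (Subset n → Fin n → ℚ) → Fin n → ℚ
lincomb c x v = sumSub (λ C → c C * x C v)

lincomb-sub-scaled : ∀ (a b : Subset n → ℚ) t (x : Subset n → Fin n → ℚ) v →
  lincomb (λ C → a C - t * b C) x v ≡ lincomb a x v - t * lincomb b x v
lincomb-sub-scaled a b t x v = begin
  sumSub (λ C → (a C - t * b C) * x C v)
    ≡⟨ sumSub-cong distribute ⟩
  sumSub (λ C → a C * x C v - t * (b C * x C v))
    ≡⟨ sumSub-distrib-- (λ C → a C * x C v) (λ C → t * (b C * x C v)) ⟩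
  lincomb a x v - sumSub (λ C → t * (b C * x C v))
    ≡⟨ cong (λ s → lincomb a x v - s) (*-distribˡ-sumSub t (λ C → b C * x C v)) ⟩
  lincomb a x v - t * lincomb b x v
    ∎
  where
  open ≡-Reasoning
  distribute : ∀ C → (a C - t * b C) * x C v ≡ a C * x C v - t * (b C * x C v)
  distribute C = solve 4 (λ a t b x → (a :- t :* b) :* x := a :* x :- t :* (b :* x)) refl (a C) t (b C) (x C v)

-- Orthogonal projection onto ℍ

module Projection {𝓑 : Family n} (bs : IsBuildingSet 𝓑) (g : Subset n → Fin n → ℚ)
  (projection : ∀ C → IsOrthProj 𝓑 (ind C) (g C)) where

  open BuildingSet 𝓑 bs

  dot-ind≡dot-g : ∀ C h → InH 𝓑 h → dot (ind C) h ≡ dot (g C) h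
  dot-ind≡dot-g C h h∈H =
    p-q≡0⇒p≡q _ _ (trans (sym (dot-distribʳ-- (ind C) (g C) h)) (proj₂ (projection C) h h∈H))

  dot-g-ind : ∀ C {K} → kappaB 𝓑 K ≡ true → dot (g C) (ind K) ≡ 0ℚ
  dot-g-ind C {K} κK = trans (dot-comm (g C) (ind K)) (trans (dot-ind K (g C)) (proj₁ (projection C) K κK))

  lincomb-g∈H : ∀ c → InH 𝓑 (lincomb c g)
  lincomb-g∈H c K κK = begin
    sumOver K (lincomb c g)                 ≡⟨ sym (dot-ind K (lincomb c g)) ⟩
    dot (ind K) (lincomb c g)               ≡⟨ dot-comm (ind K) (lincomb c g) ⟩
    dot (lincomb c g) (ind K)               ≡⟨ dot-combinationˡ c g (ind K) ⟩
    sumSub (λ C → c C * dot (g C) (ind K))  ≡⟨ sumSub-zero _ (λ C → trans (cong (c C *_) (dot-g-ind C κK))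
                                                                         (ℚ.*-zeroʳ (c C))) ⟩
    0ℚ                                      ∎
    where open ≡-Reasoning

  dot-lincomb-ind≡dot-lincomb-g : ∀ c h → InH 𝓑 h → dot (lincomb c ind) h ≡ dot (lincomb c g) h
  dot-lincomb-ind≡dot-lincomb-g c h h∈H = begin
    dot (lincomb c ind) h                  ≡⟨ dot-combinationˡ c ind h ⟩
    sumSub (λ C → c C * dot (ind C) h)     ≡⟨ sumSub-cong (λ C → cong (c C *_) (dot-ind≡dot-g C h h∈H)) ⟩
    sumSub (λ C → c C * dot (g C) h)       ≡⟨ dot-combinationˡ c g h ⟨
    dot (lincomb c g) h                    ∎
    where open ≡-Reasoning

  -- w = Σ c_C g_C lies in ℍ, hence ⟨w, w⟩ = ⟨Σ c_C 1_C, w⟩ = 0.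
  ind-dependence⇒g-dependence : ∀ c → ZeroVec (lincomb c ind) → ZeroVec (lincomb c g)
  ind-dependence⇒g-dependence c ind-dep = ∑-sq≡0⇒≡0 (lincomb c g) (begin
    dot (lincomb c g) (lincomb c g)    ≡⟨ dot-lincomb-ind≡dot-lincomb-g c _ (lincomb-g∈H c) ⟨
    dot (lincomb c ind) (lincomb c g)  ≡⟨ dot-zeroˡ _ _ ind-dep ⟩
    0ℚ                                 ∎)
    where open ≡-Reasoning

  g-dependence⇒ind-dependence⊥H : ∀ c → ZeroVec (lincomb c g) → ∀ h → InH 𝓑 h → dot (lincomb c ind) h ≡ 0ℚ
  g-dependence⇒ind-dependence⊥H c g-dep h h∈H =
    trans (dot-lincomb-ind≡dot-lincomb-g c h h∈H) (dot-zeroˡ _ h g-dep)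

  δ-δ∈H : ∀ {K v w} → InKappa 𝓑 ⊤ K → v ∈ K → w ∈ K → InH 𝓑 (λ u → δ v u - δ w u)
  δ-δ∈H {K} {v} {w} κK v∈K w∈K K′ κK′ = begin
    sumOver K′ (λ u → δ v u - δ w u)        ≡⟨ sym (dot-ind K′ _) ⟩
    dot (ind K′) (λ u → δ v u - δ w u)      ≡⟨ dot-δ-δ (ind K′) v w ⟩
    ind K′ v - ind K′ w                     ≡⟨ cong (_- ind K′ w) (ind-cong K′ (same v∈K w∈K) (same w∈K v∈K)) ⟩
    ind K′ w - ind K′ w                     ≡⟨ ℚ.+-inverseʳ (ind K′ w) ⟩
    0ℚ                                      ∎
    where
    open ≡-Reasoning
    same : ∀ {x y} → x ∈ K → y ∈ K → x ∈ K′ → y ∈ K′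
    same x∈K y∈K x∈K′ = subst (_ ∈_) (InKappa-meet⇒≡ κK (kappa⁻ 𝓑 κK′) (_ , x∈p∩q⁺ (x∈K , x∈K′))) y∈K

  g-κ≡0 : ∀ {K} → InKappa 𝓑 ⊤ K → ZeroVec (g K)
  g-κ≡0 {K} κK = ∑-sq≡0⇒≡0 (g K) (begin
    dot (g K) (g K)          ≡⟨ dot-ind≡dot-g K (g K) (proj₁ (projection K)) ⟨
    dot (ind K) (g K)        ≡⟨ dot-ind K (g K) ⟩
    sumOver K (g K)          ≡⟨ proj₁ (projection K) K (kappa⁺ 𝓑 κK) ⟩
    0ℚ                       ∎)
    where open ≡-Reasoning

  g≢0 : ∀ {C K v w} → InKappa 𝓑 ⊤ K → v ∈ K → w ∈ K → v ∈ C → w ∉ C → ¬ ZeroVec (g C)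
  g≢0 {C} {K} {v} {w} κK v∈K w∈K v∈C w∉C g≡0 = ℚ.1≢0 (begin
    1ℚ                                  ≡⟨ sym (ℚ.+-identityʳ 1ℚ) ⟩
    1ℚ - 0ℚ                             ≡⟨ cong₂ _-_ (ind-∈ v∈C) (ind-∉ w∉C) ⟨
    ind C v - ind C w                   ≡⟨ dot-δ-δ (ind C) v w ⟨
    dot (ind C) (λ u → δ v u - δ w u)   ≡⟨ dot-ind≡dot-g C _ (δ-δ∈H κK v∈K w∈K) ⟩
    dot (g C) (λ u → δ v u - δ w u)     ≡⟨ dot-zeroˡ _ _ g≡0 ⟩
    0ℚ                                  ∎)
    where open ≡-Reasoning

  lincomb-ind-constant-on-κ : ∀ c → ZeroVec (lincomb c g) → ∀ {K v w} → InKappa 𝓑 ⊤ K → v ∈ K → w ∈ K →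
    lincomb c ind v ≡ lincomb c ind w
  lincomb-ind-constant-on-κ c g-dep κK v∈K w∈K = p-q≡0⇒p≡q _ _
    (trans (sym (dot-δ-δ (lincomb c ind) _ _)) (g-dependence⇒ind-dependence⊥H c g-dep _ (δ-δ∈H κK v∈K w∈K)))

ind-inclusion-exclusion : ∀ {B B′ P : Subset n} → B ⊆ P → B′ ⊆ P → ∀ v →
  ind B v + ind B′ v + ind (P ─ (B ∪ B′)) v - ind P v - ind (B ∩ B′) v ≡ 0ℚ
ind-inclusion-exclusion {B = B} {B′} {P} B⊆P B′⊆P v with v ∈? B | v ∈? B′
... | yes v∈B | yes v∈B′
  rewrite ind-∉ (x∈q⇒x∉p─q P (B ∪ B′) (∈-∪ˡ v∈B)) | ind-∈ (B⊆P v∈B) | ind-∈ (x∈p∩q⁺ (v∈B , v∈B′)) = refl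
... | yes v∈B | no v∉B′
  rewrite ind-∉ (x∈q⇒x∉p─q P (B ∪ B′) (∈-∪ˡ v∈B)) | ind-∈ (B⊆P v∈B) | ind-∉ (v∉B′ ∘ p∩q⊆q B B′) = refl
... | no v∉B | yes v∈B′
  rewrite ind-∉ (x∈q⇒x∉p─q P (B ∪ B′) (∈-∪ʳ {A = B} v∈B′)) | ind-∈ (B′⊆P v∈B′) | ind-∉ (v∉B ∘ p∩q⊆p B B′) = refl
... | no v∉B | no v∉B′ with v ∈? P
...   | yes v∈P
  rewrite ind-∈ (x∈p∧x∉q⇒x∈p─q v∈P ([ v∉B , v∉B′ ]′ ∘ x∈p∪q⁻ B B′)) | ind-∉ (v∉B ∘ p∩q⊆p B B′) = refl
...   | no v∉P
  rewrite ind-∉ (v∉P ∘ p─q⊆p P (B ∪ B′)) | ind-∉ (v∉B ∘ p∩q⊆p B B′) = refl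

module _ {𝓑 : Family n} (bs : IsBuildingSet 𝓑) where
  open BuildingSet 𝓑 bs

  [κ]*ind-off : ∀ U K v → (kappa 𝓑 U K ≡ true → v ∉ K) → [ kappa 𝓑 U K ]ℚ * ind K v ≡ 0ℚ
  [κ]*ind-off U K v v∉K with kappa 𝓑 U K
  ... | false = ℚ.*-zeroˡ (ind K v)
  ... | true = trans (ℚ.*-identityˡ (ind K v)) (ind-∉ (v∉K refl))

  κ-partition : ∀ U v → sumSub (λ K → [ kappa 𝓑 U K ]ℚ * ind K v) ≡ ind U v
  κ-partition U v with v ∈? U
  ... | no v∉U = sumSub-zero _ λ K → [κ]*ind-off U K v λ κK v∈K → v∉U (proj₁ (proj₂ (kappa⁻ 𝓑 κK)) v∈K)
  ... | yes v∈U with InKappa-covers v∈U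
  ...   | K₀ , κK₀ , v∈K₀ = trans (sumSub-single _ K₀ λ K K≢K₀ → [κ]*ind-off U K v λ κK v∈K →
                                     K≢K₀ (InKappa-meet⇒≡ (kappa⁻ 𝓑 κK) κK₀ (v , x∈p∩q⁺ (v∈K , v∈K₀))))
                                  (cong₂ (λ b x → [ b ]ℚ * x) (kappa⁺ 𝓑 κK₀) (ind-∈ v∈K₀))

-- Dependences among g-vectors of a maximal nested set

module _ {𝓑 : Family n} (bs : IsBuildingSet 𝓑) {N : Family n} (mxN : IsMaxNested 𝓑 N)
  (g : Subset n → Fin n → ℚ) (projection : ∀ C → IsOrthProj 𝓑 (ind C) (g C)) where

  open BuildingSet 𝓑 bs
  open IsNested (proj₁ mxN)
  open Nested bs (proj₁ mxN)
  open MaximalNested bs mxN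
  open Projection bs g projection

  lincomb-ind-at-privates : ∀ μ → (∀ D → N D ≡ false → μ D ≡ 0ℚ) →
    ∀ {C Q vC vQ} → N C ≡ true → Minimal (strictlyAbove C) Q → Private C vC → Private Q vQ →
    lincomb μ ind vC - lincomb μ ind vQ ≡ μ C
  lincomb-ind-at-privates μ off-N {C} {Q} {vC} {vQ} nC Q-parent vC-private vQ-private =
    trans (sym (sumSub-distrib-- (λ D → μ D * ind D vC) (λ D → μ D * ind D vQ)))
          (trans (sumSub-cong separated) (sumSub-[==] C μ))
    where
    separated : ∀ D → μ D * ind D vC - μ D * ind D vQ ≡ [ D == C ]ℚ * μ D
    separated D with N D in nD
    ... | false rewrite off-N D nD | ℚ.*-zeroˡ (ind D vC) | ℚ.*-zeroˡ (ind D vQ) | ℚ.*-zeroʳ [ D == C ]ℚ = refl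
    ... | true with ≡-dec Bool._≟_ D C
    ...   | yes refl rewrite ind-∈ (proj₁ vC-private) | ind-∉ (vQ∉C nC Q-parent vC-private vQ-private)
                                = solve 1 (λ m → m :* con 1ℚ :- m :* con 0ℚ := con 1ℚ :* m) refl (μ C)
    ...   | no D≢C rewrite ind-cong D (private-of-C⇒private-of-Q nC Q-parent vC-private vQ-private nD D≢C)
                                            (private-of-Q⇒private-of-C nC Q-parent vC-private vQ-private nD)
                               | ℚ.*-zeroˡ (μ D) = ℚ.+-inverseʳ (μ D * ind D vQ)

  -- Compare the indicator combination at a private element of C and one of its parent Q:
  -- only C separates them, yet both lie in the maximal block containing C.
  dependence-within-N-vanishes : ∀ μ → (∀ D → N D ≡ false → μ D ≡ 0ℚ) → ZeroVec (lincomb μ g) →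
    ∀ {C} → N C ≡ true → ¬ ZeroVec (g C) → μ C ≡ 0ℚ
  dependence-within-N-vanishes μ off-N dep {C} nC g≢0 with maxBlock-above (blocks C nC)
  ... | K , C⊆K , κK
    with minimal-below (strictlyAbove C) K
           (strictlyAbove⁺ (maxBlocks K (kappa⁺ 𝓑 κK)) (⊆∧≢⇒⊂ C⊆K λ { refl → g≢0 (g-κ≡0 κK) }))
  ... | Q , Q⊆K , Q-parent
    with private-exists nC | private-exists (proj₁ (strictlyAbove⁻ {C} (proj₁ Q-parent)))
  ... | vC , vC-private | vQ , vQ-private = begin
    μ C                                    ≡⟨ lincomb-ind-at-privates μ off-N nC Q-parent vC-private vQ-private ⟨
    lincomb μ ind vC - lincomb μ ind vQ    ≡⟨ cong (λ x → lincomb μ ind vC - x) constant ⟨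
    lincomb μ ind vC - lincomb μ ind vC    ≡⟨ ℚ.+-inverseʳ (lincomb μ ind vC) ⟩
    0ℚ                                     ∎
    where
    open ≡-Reasoning
    constant : lincomb μ ind vC ≡ lincomb μ ind vQ
    constant = lincomb-ind-constant-on-κ μ dep κK (C⊆K (proj₁ vC-private)) (Q⊆K (proj₁ vQ-private))

-- The dependence of an exchange

module Dependence {𝓑 : Family n} (bs : IsBuildingSet 𝓑) {N N′ : Family n}
  (mxN : IsMaxNested 𝓑 N) (mxN′ : IsMaxNested 𝓑 N′) {B B′ P : Subset n}
  (nB : N B ≡ true) (nB′ : N′ B′ ≡ true) (B≢B′ : B ≢ B′)
  (exchange : ∀ C → (N C ∧ not (C == B)) ≡ (N′ C ∧ not (C == B′)))
  (parent : IsParent N B P)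
  (g : Subset n → Fin n → ℚ) (projection : ∀ C → IsOrthProj 𝓑 (ind C) (g C)) where

  open BuildingSet 𝓑 bs
  open Exchange bs mxN mxN′ nB nB′ B≢B′ exchange parent
  open Projection bs g projection

  coeff : Subset n → ℚ
  coeff = exchangeCoeff 𝓑 B B′ P

  κ₁ κ₂ : Family n
  κ₁ = kappa 𝓑 (P ─ (B ∪ B′))
  κ₂ = kappa 𝓑 (B ∩ B′)

  sumSub-coeff : ∀ (f : Subset n → ℚ) → sumSub (λ C → coeff C * f C) ≡
    f B + f B′ + sumSub (λ K → [ κ₁ K ]ℚ * f K) - f P - sumSub (λ K → [ κ₂ K ]ℚ * f K)
  sumSub-coeff f = begin
    sumSub (λ C → coeff C * f C)
      ≡⟨ sumSub-cong (λ C → solve 6 (λ a b c d e x → (a :+ b :+ c :- d :- e) :* x :=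
                                       a :* x :+ b :* x :+ c :* x :- d :* x :- e :* x) refl
                                     [ C == B ]ℚ [ C == B′ ]ℚ [ κ₁ C ]ℚ [ C == P ]ℚ [ κ₂ C ]ℚ (f C)) ⟩
    sumSub (λ C → at B C + at B′ C + fκ₁ C - at P C - fκ₂ C)
      ≡⟨ sumSub-distrib-- _ fκ₂ ⟩
    sumSub (λ C → at B C + at B′ C + fκ₁ C - at P C) - sumSub fκ₂
      ≡⟨ cong (_- sumSub fκ₂) (sumSub-distrib-- _ (at P)) ⟩
    sumSub (λ C → at B C + at B′ C + fκ₁ C) - sumSub (at P) - sumSub fκ₂
      ≡⟨ cong (λ s → s - sumSub (at P) - sumSub fκ₂)
              (trans (sumSub-distrib-+ _ fκ₁) (cong (_+ sumSub fκ₁) (sumSub-distrib-+ (at B) (at B′)))) ⟩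
    sumSub (at B) + sumSub (at B′) + sumSub fκ₁ - sumSub (at P) - sumSub fκ₂
      ≡⟨ cong₂ (λ x y → x - y - sumSub fκ₂)
               (cong₂ (λ x y → x + y + sumSub fκ₁) (sumSub-[==] B f) (sumSub-[==] B′ f)) (sumSub-[==] P f) ⟩
    f B + f B′ + sumSub fκ₁ - f P - sumSub fκ₂
      ∎
    where
    open ≡-Reasoning
    at : Subset n → Subset n → ℚ
    at X C = [ C == X ]ℚ * f C
    fκ₁ fκ₂ : Subset n → ℚ
    fκ₁ K = [ κ₁ K ]ℚ * f K
    fκ₂ K = [ κ₂ K ]ℚ * f K

  ind-dependence : ZeroVec (lincomb coeff ind)
  ind-dependence v = begin
    lincomb coeff ind v
      ≡⟨ sumSub-coeff (λ C → ind C v) ⟩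
    ind B v + ind B′ v + sumSub (λ K → [ κ₁ K ]ℚ * ind K v) - ind P v - sumSub (λ K → [ κ₂ K ]ℚ * ind K v)
      ≡⟨ cong₂ (λ x y → ind B v + ind B′ v + x - ind P v - y) (κ-partition bs _ v) (κ-partition bs _ v) ⟩
    ind B v + ind B′ v + ind (P ─ (B ∪ B′)) v - ind P v - ind (B ∩ B′) v
      ≡⟨ ind-inclusion-exclusion (proj₁ B⊂P) B′⊆P v ⟩
    0ℚ ∎
    where open ≡-Reasoning

  g-dependence : ZeroVec (lincomb coeff g)
  g-dependence = ind-dependence⇒g-dependence coeff ind-dependence

  exchange-identity : ∀ v → g B v + g B′ v + sumSub (λ K → [ κ₁ K ]ℚ * g K v)
                            ≡ g P v + sumSub (λ K → [ κ₂ K ]ℚ * g K v)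
  exchange-identity v = x-y-z≡0⇒x≡y+z (trans (sym (sumSub-coeff (λ C → g C v))) (g-dependence v))

  coeff-values : ∀ {C a b c d e} → (C == B) ≡ a → (C == B′) ≡ b → κ₁ C ≡ c → (C == P) ≡ d → κ₂ C ≡ e →
    coeff C ≡ [ a ]ℚ + [ b ]ℚ + [ c ]ℚ - [ d ]ℚ - [ e ]ℚ
  coeff-values refl refl refl refl refl = refl

  coeff-outside : ∀ C → (N C ∨ N′ C) ≡ false → coeff C ≡ 0ℚ
  coeff-outside C C∉ = coeff-values
    (≢⇒== (false-true⇒≢ {f = N} nC nB))
    (≢⇒== (false-true⇒≢ {f = N′} nC′ nB′))
    (¬-not λ κ₁C → true≢false (κ[P─B∪B′]⊆N (kappa⁻ 𝓑 κ₁C)) nC)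
    (≢⇒== (false-true⇒≢ {f = N} nC nP))
    (¬-not λ κ₂C → true≢false (κ[B∩B′]⊆N (kappa⁻ 𝓑 κ₂C)) nC)
    where
    nC : N C ≡ false
    nC = ∨-false⁻ˡ C∉
    nC′ : N′ C ≡ false
    nC′ = ∨-false⁻ʳ {a = N C} C∉

  coeff-B : coeff B ≡ 1ℚ
  coeff-B = coeff-values
    (==-refl {C = B})
    (≢⇒== B≢B′)
    (kappa-false 𝓑 (Nonempty⇒⊈─ neB ∈-∪ˡ))
    (≢⇒== (⊂⇒≢ B⊂P))
    (kappa-false 𝓑 λ B⊆B∩B′ → B⊈B′ (p∩q⊆q B B′ ∘ B⊆B∩B′))

  coeff-B′ : coeff B′ ≡ 1ℚ
  coeff-B′ = coeff-values
    (≢⇒== (B≢B′ ∘ sym))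
    (==-refl {C = B′})
    (kappa-false 𝓑 (Nonempty⇒⊈─ neB′ (∈-∪ʳ {A = B})))
    (≢⇒== {C = B′} {P} λ { refl → B′∉N nP })
    (kappa-false 𝓑 λ B′⊆B∩B′ → B′⊈B (p∩q⊆p B B′ ∘ B′⊆B∩B′))

  g-B≢0 : ¬ ZeroVec (g B)
  g-B≢0 with maxBlock-above (N.blocks P nP) | neB | B⊂P
  ... | K , P⊆K , κK | v , v∈B | B⊆P , w , w∈P , w∉B = g≢0 κK (P⊆K (B⊆P v∈B)) (P⊆K w∈P) v∈B w∉B

  -- Subtracting the multiple of the exchange dependence that agrees at B′ leaves a dependence within N.
  dependence-unique : ∀ (λc : Subset n → ℚ) → (∀ C → (N C ∨ N′ C) ≡ false → λc C ≡ 0ℚ) →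
    ZeroVec (lincomb λc g) →
    ∀ C → (N C ∨ N′ C) ≡ true → ¬ ZeroVec (g C) → λc C ≡ λc B′ * coeff C
  dependence-unique λc off dep C C∈ g≢0 with N C in nC
  ... | true = p-q≡0⇒p≡q _ _ (dependence-within-N-vanishes bs mxN g projection μ μ-off μ-dep nC g≢0)
    where
    t : ℚ
    t = λc B′
    μ : Subset n → ℚ
    μ D = λc D - t * coeff D
    μ-dep : ZeroVec (lincomb μ g)
    μ-dep v = begin
      lincomb μ g v                          ≡⟨ lincomb-sub-scaled λc coeff t g v ⟩
      lincomb λc g v - t * lincomb coeff g v ≡⟨ cong₂ (λ x y → x - t * y) (dep v) (g-dependence v) ⟩
      0ℚ - t * 0ℚ                            ≡⟨ cong (λ s → 0ℚ - s) (ℚ.*-zeroʳ t) ⟩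
      0ℚ                                     ∎
      where open ≡-Reasoning
    μ-B′ : μ B′ ≡ 0ℚ
    μ-B′ = begin
      t - t * coeff B′  ≡⟨ cong (λ c → t - t * c) coeff-B′ ⟩
      t - t * 1ℚ        ≡⟨ cong (λ s → t - s) (ℚ.*-identityʳ t) ⟩
      t - t             ≡⟨ ℚ.+-inverseʳ t ⟩
      0ℚ                ∎
      where open ≡-Reasoning
    μ-off : ∀ D → N D ≡ false → μ D ≡ 0ℚ
    μ-off D nD with N′ D in nD′
    ... | false = let D∉ = ∨-false nD nD′ in
      trans (cong₂ (λ x y → x - t * y) (off D D∉) (coeff-outside D D∉)) (cong (λ s → 0ℚ - s) (ℚ.*-zeroʳ t))
    ... | true = subst (λ X → μ X ≡ 0ℚ)
      (sym (decidable-stable (≡-dec Bool._≟_ D B′) λ D≢B′ → true≢false (N′⇒N nD′ D≢B′) nD)) μ-B′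
  ... | false = subst (λ X → λc X ≡ λc B′ * coeff X)
      (sym (decidable-stable (≡-dec Bool._≟_ C B′) λ C≢B′ → true≢false (N′⇒N C∈ C≢B′) nC))
      (sym (trans (cong (λc B′ *_) coeff-B′) (ℚ.*-identityʳ (λc B′))))

proposition3p18 :
  (n : ℕ) (𝓑 : Family n) → IsBuildingSet 𝓑 →
  (N N' : Family n) → IsMaxNested 𝓑 N → IsMaxNested 𝓑 N' →
  (B B' P : Subset n) → N B ≡ true → N' B' ≡ true → B ≢ B' →
  (∀ C → (N C ∧ not (C == B)) ≡ (N' C ∧ not (C == B'))) →
  IsParent N B P →
  (g : Subset n → Fin n → ℚ) → (∀ C → IsOrthProj 𝓑 (ind C) (g C)) →
  -- the displayed identity holds
  (∀ v → g B v + g B' v + sumSub (λ K → [ kappa 𝓑 (P ─ (B ∪ B')) K ]ℚ * g K v)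
         ≡ g P v + sumSub (λ K → [ kappa 𝓑 (B ∩ B') K ]ℚ * g K v))
  -- it is a nontrivial dependence among g-vectors of N ∪ N'
  × (∀ C → (N C ∨ N' C) ≡ false → exchangeCoeff 𝓑 B B' P C ≡ 0ℚ)
  × (Σ (Subset n) λ C → (N C ∨ N' C) ≡ true × ¬ ZeroVec (g C)
       × exchangeCoeff 𝓑 B B' P C ≢ 0ℚ)
  -- every dependence among g-vectors of N ∪ N' is a multiple of it
  × (∀ (λc : Subset n → ℚ) →
       (∀ C → (N C ∨ N' C) ≡ false → λc C ≡ 0ℚ) →
       (∀ v → sumSub (λ C → λc C * g C v) ≡ 0ℚ) →
       ∃ λ (t : ℚ) → ∀ C → (N C ∨ N' C) ≡ true → ¬ ZeroVec (g C) →
         λc C ≡ t * exchangeCoeff 𝓑 B B' P C)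
proposition3p18 n 𝓑 bs N N′ mxN mxN′ B B′ P nB nB′ B≢B′ exchange parent g projection =
    exchange-identity
  , coeff-outside
  , (B , ∨⁺ˡ nB , g-B≢0 , λ coeff-B≡0 → ℚ.1≢0 (trans (sym coeff-B) coeff-B≡0))
  , λ λc off dep → λc B′ , dependence-unique λc off dep
  where open Dependence bs mxN mxN′ nB nB′ B≢B′ exchange parent g projection
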